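{- Let $n\geq 3$, let $M_0$ be a simple matroid on a ground set $E_0$ disjoint from $[n]$, fix $\epsilon_0\in E_0$, and let $M=C_n\oplus M_0$ on $E=[n]\cup E_0$ and $M'=P^n_{\epsilon_0}\oplus S$ on $\bar E\cup\{p\}$. Let $\hat\phi:\Lambda(E)\to\Lambda(\bar E\cup\{p\})$ be the algebra homomorphism with $\hat\phi(e_i)=\bar e_i-\bar e_n+e_p$ for $i\in[n-1]$, $\hat\phi(e_n)=e_p$, and $\hat\phi(e_\epsilon)=\bar e_\epsilon$ for $\epsilon\in E_0$. Then $\hat\phi(I(M))\subseteq I(M')$.
   Context: For a finite set $E$, $\Lambda(E)$ is the exterior algebra over a fixed commutative ring $K$ generated by degree-one elements $e_i$, $i\in E$; $\partial$ is the $K$-linear map with $\partial(e_{i_1}\cdots e_{i_k})=\sum_{j=1}^k(-1)^{j-1}e_{i_1}\cdots\widehat{e_{i_j}}\cdots e_{i_k}$, and for a simple matroid $N$ on $E$, $I(N)$ is the ideal generated by $\partial(e_{i_1}\cdots e_{i_k})$ for all circuits $\{i_1,\dots,i_k\}$ of $N$. $C_n$ is the matroid on $[n]=\{1,\dots,n\}$ of rank $n-1$ whose only circuit is $[n]$; $S$ is the rank-one matroid on a single point $p$; $\oplus$ is direct sum. The parallel connection $P^n_{\epsilon_0}$: on $[n]\cup E_0$ identify $1$ with $\epsilon_0$ (other classes singletons), write $\bar q$ for the class of $q$, $\bar X$ for the set of classes of elements of $X$, $\bar E$ for the set of classes; $P^n_{\epsilon_0}$ is the matroid on $\bar E$ whose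 circuits are the $\bar C$ with $C$ a circuit of $C_n$ or of $M_0$, together with the sets $\overline{C-1}\cup\overline{C'-\epsilon_0}$ with $1\in C$ a circuit of $C_n$ and $\epsilon_0\in C'$ a circuit of $M_0$. The generator of $\Lambda(\bar E\cup\{p\})$ corresponding to $\bar\epsilon$ is written $\bar e_\epsilon$ (so $\bar e_1=\bar e_{\epsilon_0}$). -}

module Defs where

open import Level using (_⊔_)
open import Data.Nat using (ℕ; zero; suc; _≤_; _≟_)
open import Data.Fin using (Fin; zero; suc; toℕ; fromℕ; splitAt; _↑ˡ_; _↑ʳ_)
open import Data.Fin.Subset
  using (Subset; inside; outside; _∈_; _∉_; _⊆_; _∪_; _-_; ∣_∣; ⁅_⁆)
  renaming (⊥ to ∅; ⊤ to full)
open import Data.Vec using (Vec; []; _∷_; _++_)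
open import Data.List using (List; []; _∷_; map) renaming (_++_ to _++L_)
open import Data.Product using (Σ; _×_; _,_)
open import Data.Sum using (_⊎_; inj₁; inj₂)
open import Data.Empty using () renaming (⊥ to Empty)
open import Relation.Nullary using (¬_; yes; no)
open import Relation.Binary.PropositionalEquality using (_≡_; _≢_)
open import Function using (_∘_; _⇔_)
open import Algebra.Bundles using (CommutativeRing)

record Matroid (k : ℕ) : Set₁ where
  field
    Circuit : Subset k → Set
    C1 : ¬ Circuit ∅
    C2 : ∀ {C D} → Circuit C → Circuit D → C ⊆ D → C ≡ D
    C3 : ∀ {C D e} → Circuit C → Circuit D → C ≢ D → e ∈ C → e ∈ D →
         Σ (Subset k) λ F → Circuit F × F ⊆ ((C ∪ D) - e)

-- simple: no loops and no parallel pairs, i.e. every circuit has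
-- at least three elements
Simple : ∀ {k} → Matroid k → Set
Simple {k} M = ∀ (C : Subset k) → Matroid.Circuit M C → 3 ≤ ∣ C ∣

-- Source E = [n] ∪ E₀ is Fin (n + k): index i ↑ˡ k (i : Fin n) is the
--  element (toℕ i + 1) of [n]; n ↑ʳ ε is ε ∈ E₀ = Fin k.
--  Target Ē ∪ {p} is Fin (n + k): slot zero ↑ˡ k is p, slot j ↑ˡ k
--  (j ≠ 0) is the class of element j+1 of [n], slot n ↑ʳ ε is the
--  class of ε ∈ E₀ (the class of ε₀ also contains 1).

bar : (n k : ℕ) → Fin k → Fin (n Data.Nat.+ k) → Fin (n Data.Nat.+ k)
bar n k ε₀ x with splitAt n x
... | inj₁ zero    = n ↑ʳ ε₀
... | inj₁ (suc i) = suc i ↑ˡ k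
... | inj₂ ε       = n ↑ʳ ε

IsImage : (n k : ℕ) → Fin k → Subset (n Data.Nat.+ k) → Subset (n Data.Nat.+ k) → Set
IsImage n k ε₀ X D =
  ∀ t → (t ∈ D) ⇔ Σ (Fin (n Data.Nat.+ k)) λ x → x ∈ X × bar n k ε₀ x ≡ t

CnCircuit : (n : ℕ) → Subset n → Set
CnCircuit n C = C ≡ full

CircM : (n k : ℕ) → Matroid k → Subset (n Data.Nat.+ k) → Set
CircM n k M₀ D =
  (Σ (Subset n) λ C → CnCircuit n C × D ≡ C ++ ∅)
  ⊎ (Σ (Subset k) λ C' → Matroid.Circuit M₀ C' × D ≡ ∅ ++ C')

CircP : (n k : ℕ) → Matroid k → Fin k → Subset (n Data.Nat.+ k) → Set
CircP n k M₀ ε₀ D =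
  (Σ (Subset (n Data.Nat.+ k)) λ C → CircM n k M₀ C × IsImage n k ε₀ C D)
  ⊎ (Σ (Subset n) λ C → Σ (Subset k) λ C' →
       CnCircuit n C × (Σ (Fin n) λ i → toℕ i ≡ 0 × i ∈ C)
     × Matroid.Circuit M₀ C' × ε₀ ∈ C'
     × (∀ t → (t ∈ D) ⇔
          ((Σ (Fin n) λ i → i ∈ C × toℕ i ≢ 0 × bar n k ε₀ (i ↑ˡ k) ≡ t)
           ⊎ (Σ (Fin k) λ ε → ε ∈ C' × ε ≢ ε₀ × bar n k ε₀ (n ↑ʳ ε) ≡ t))))

-- circuits of S: S is a single non-loop point, so it has no circuits
CircS : Subset 1 → Set
CircS _ = Empty

-- circuits of M' = P^n_{ε₀} ⊕ S on Ē ∪ {p}; with our encoding the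
-- point p is slot zero ↑ˡ k, which lies in no circuit of P, and S
-- contributes no circuits.
CircM' : (n k : ℕ) → Matroid k → Fin k → Subset (n Data.Nat.+ k) → Set
CircM' n k M₀ ε₀ D = CircP n k M₀ ε₀ D

-- Exterior algebra Λ(Fin N) over a commutative ring K, as the free
-- K-module on subsets S = {i₁ < ⋯ < i_m}, the basis element e_S being
-- e_{i₁} ⋯ e_{i_m}.

allSubsets : (N : ℕ) → List (Subset N)
allSubsets zero    = [] ∷ []
allSubsets (suc N) = map (inside ∷_) (allSubsets N) ++L map (outside ∷_) (allSubsets N)

module Ext {c ℓ} (K : CommutativeRing c ℓ) where
  open CommutativeRing K using (Carrier; _≈_; _+_; _*_; -_; 0#; 1#)

  Λ : ℕ → Set c
  Λ N = Subset N → Carrier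

  _≈Λ_ : ∀ {N} → Λ N → Λ N → Set ℓ
  f ≈Λ g = ∀ U → f U ≈ g U

  sumL : ∀ {a} {A : Set a} → List A → (A → Carrier) → Carrier
  sumL []       f = 0#
  sumL (x ∷ xs) f = f x + sumL xs f

  negPow : ℕ → Carrier
  negPow zero    = 1#
  negPow (suc m) = - negPow m

  δ : ∀ {N} → Subset N → Subset N → Carrier
  δ []            []            = 1#
  δ (inside ∷ S)  (inside ∷ U)  = δ S U
  δ (outside ∷ S) (outside ∷ U) = δ S U
  δ (inside ∷ S)  (outside ∷ U) = 0#
  δ (outside ∷ S) (inside ∷ U)  = 0#

  basis : ∀ {N} → Subset N → Λ N
  basis = δ

  0Λ : ∀ {N} → Λ N
  0Λ _ = 0#

  1Λ : ∀ {N} → Λ N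
  1Λ = basis ∅

  _+Λ_ : ∀ {N} → Λ N → Λ N → Λ N
  (f +Λ g) U = f U + g U

  -Λ_ : ∀ {N} → Λ N → Λ N
  (-Λ f) U = - f U

  -- coefficient of e_U in e_S e_T
  wc : ∀ {N} → Subset N → Subset N → Subset N → Carrier
  wc []            []            []            = 1#
  wc (inside ∷ S)  (inside ∷ T)  _             = 0#
  wc (inside ∷ S)  (outside ∷ T) (inside ∷ U)  = wc S T U
  wc (inside ∷ S)  (outside ∷ T) (outside ∷ U) = 0#
  wc (outside ∷ S) (inside ∷ T)  (inside ∷ U)  = negPow ∣ S ∣ * wc S T U
  wc (outside ∷ S) (inside ∷ T)  (outside ∷ U) = 0#
  wc (outside ∷ S) (outside ∷ T) (outside ∷ U) = wc S T U
  wc (outside ∷ S) (outside ∷ T) (inside ∷ U)  = 0#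

  _∧_ : ∀ {N} → Λ N → Λ N → Λ N
  _∧_ {N} f g U =
    sumL (allSubsets N) λ S → sumL (allSubsets N) λ T → (f S * g T) * wc S T U

  -- ∂(e_S), S = {i₁ < ⋯ < i_m}: Σ_j (-1)^{j-1} e_{S - i_j}
  ∂e : ∀ {N} → Subset N → Λ N
  ∂e []            []            = 0#
  ∂e (inside ∷ S)  (outside ∷ U) = δ S U
  ∂e (inside ∷ S)  (inside ∷ U)  = - ∂e S U
  ∂e (outside ∷ S) (outside ∷ U) = ∂e S U
  ∂e (outside ∷ S) (inside ∷ U)  = 0#

  data Ideal {N : ℕ} (Circ : Subset N → Set) : Λ N → Set (c ⊔ ℓ) where
    gen  : ∀ {C} → Circ C → Ideal Circ (∂e C)
    zer  : Ideal Circ 0Λ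
    add  : ∀ {x y} → Ideal Circ x → Ideal Circ y → Ideal Circ (x +Λ y)
    lmul : ∀ a {x} → Ideal Circ x → Ideal Circ (a ∧ x)
    rmul : ∀ {x} a → Ideal Circ x → Ideal Circ (x ∧ a)
    resp : ∀ {x y} → x ≈Λ y → Ideal Circ x → Ideal Circ y

  -- the algebra homomorphism Λ(Fin N) → Λ(Fin L) sending e_i ↦ g i:
  -- e_{i₁}⋯e_{i_m} ↦ g i₁ ∧ ⋯ ∧ g i_m, extended K-linearly
  mono : ∀ {N L} → (Fin N → Λ L) → Subset N → Λ L
  mono g []            = 1Λ
  mono g (inside ∷ S)  = g zero ∧ mono (g ∘ suc) S
  mono g (outside ∷ S) = mono (g ∘ suc) S

  extHom : ∀ {N L} → (Fin N → Λ L) → Λ N → Λ L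
  extHom {N} g f U = sumL (allSubsets N) λ S → f S * mono g S U

  φgenN : ∀ {m} k → Fin k → Fin (suc m) → Λ (suc m Data.Nat.+ k)
  φgenN {m} k ε₀ i with toℕ i ≟ m
  ... | yes _ = basis ⁅ zero ↑ˡ k ⁆
  ... | no  _ =
    (basis ⁅ bar (suc m) k ε₀ (i ↑ˡ k) ⁆
      +Λ (-Λ basis ⁅ bar (suc m) k ε₀ (fromℕ m ↑ˡ k) ⁆))
      +Λ basis ⁅ zero ↑ˡ k ⁆

  φgen : (n k : ℕ) → Fin k → Fin (n Data.Nat.+ k) → Λ (n Data.Nat.+ k)
  φgen zero    k ε₀ x = basis ⁅ x ⁆   -- junk case, excluded by n ≥ 3
  φgen (suc m) k ε₀ x with splitAt (suc m) x
  ... | inj₁ i = φgenN k ε₀ i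
  ... | inj₂ ε = basis ⁅ bar (suc m) k ε₀ x ⁆

  φ̂ : (n k : ℕ) → Fin k → Λ (n Data.Nat.+ k) → Λ (n Data.Nat.+ k)
  φ̂ n k ε₀ = extHom (φgen n k ε₀)

{-# OPTIONS --safe #-}
-- φ̂ is the algebra map sending each generator e_i to a degree-one element g_i
-- whose coefficients sum to 1.  Since ∂ is an antiderivation with ∂ g_i = 1,
-- ∂ ∘ φ̂ = φ̂ ∘ ∂ on monomials, so φ̂ (∂ e_C) = ∂ (φ̂ e_C) and it suffices to
-- treat the generators ∂ e_C of I(M).  A circuit of M₀ is fixed by φ̂.  For the
-- circuit [n], put y_i = ē_i - ē_n, whose coefficients sum to 0.  As squares of
-- degree-one elements vanish,
--   φ̂ e_[n] = (y_1 + e_p) ⋯ (y_{n-1} + e_p) e_p = y_1 ⋯ y_{n-1} e_p ,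
-- whose boundary ±y_1 ⋯ y_{n-1} does not depend on the last factor.  Replacing
-- e_p by ē_n and undoing the same manipulation gives ±∂ (ē_1 ⋯ ē_n) = ±∂ e_D,
-- where D, the image of [n] in Ē, is a circuit of the parallel connection.
module Submission where

open import Defs
open import Level using (_⊔_)
open import Function using (_∘_)
open import Function.Bundles using (mk⇔)
open import Data.Empty using (⊥-elim)
open import Data.Product using (Σ; _×_; _,_; proj₂)
open import Data.Sum using (_⊎_; inj₁; inj₂)
open import Data.Nat using (ℕ; zero; suc; _≤_; _<_; s≤s; _≟_) renaming (_+_ to _+ℕ_)
open import Data.Nat.Properties using (<-irrefl)
open import Data.Fin using (Fin; zero; suc; toℕ; splitAt; _↑ˡ_; _↑ʳ_; fromℕ; inject₁)
open import Data.Fin.Properties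
  using (splitAt-↑ˡ; splitAt-↑ʳ; splitAt⁻¹-↑ˡ; splitAt⁻¹-↑ʳ; toℕ-fromℕ; toℕ-inject₁; toℕ<n)
open import Data.Fin.Subset using (Subset; inside; outside; _∈_; ∣_∣; ⁅_⁆) renaming (⊥ to ∅; ⊤ to full)
open import Data.Fin.Subset.Properties using (∣⊥∣≡0; ∣⁅x⁆∣≡1; ∈⊤; ∉⊥; x∈⁅x⁆; x∈⁅y⁆⇒x≡y)
open import Data.Vec using ([]; _∷_; _++_; here; there)
open import Data.List using (List; []; _∷_; map) renaming (_++_ to _++L_)
open import Relation.Nullary using (yes; no)
open import Relation.Binary.PropositionalEquality as ≡ using (_≡_)
open import Relation.Binary.Bundles using (Setoid)
import Relation.Binary.Reasoning.Setoid as SetoidReasoning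
open import Algebra.Bundles using (CommutativeRing)
import Algebra.Properties.Ring as RingProperties
import Algebra.Properties.CommutativeSemigroup as CommutativeSemigroupProperties

module ExteriorAlgebra {c ℓ} (K : CommutativeRing c ℓ) where
  open CommutativeRing K hiding (zero)
  open Ext K
  open RingProperties ring using (-‿distribˡ-*; -‿distribʳ-*; -1*x≈-x; -0#≈0#; -‿involutive; -‿+-comm)
  open CommutativeSemigroupProperties *-commutativeSemigroup using (interchange; x∙yz≈y∙xz)
  open CommutativeSemigroupProperties +-commutativeSemigroup using () renaming (interchange to +-interchange)

  module Coefficients where
    open SetoidReasoning setoid

    module _ {a} {A : Set a} where
      sumL-cong : ∀ (xs : List A) {f g : A → Carrier} → (∀ x → f x ≈ g x) → sumL xs f ≈ sumL xs g
      sumL-cong []       p = refl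
      sumL-cong (x ∷ xs) p = +-cong (p x) (sumL-cong xs p)

      sumL-zero : ∀ (xs : List A) {f : A → Carrier} → (∀ x → f x ≈ 0#) → sumL xs f ≈ 0#
      sumL-zero []       p = refl
      sumL-zero (x ∷ xs) p = trans (+-cong (p x) (sumL-zero xs p)) (+-identityʳ 0#)

      sumL-+ : ∀ (xs : List A) (f g : A → Carrier) → sumL xs (λ x → f x + g x) ≈ sumL xs f + sumL xs g
      sumL-+ []       f g = sym (+-identityʳ 0#)
      sumL-+ (x ∷ xs) f g = trans (+-cong refl (sumL-+ xs f g)) (+-interchange _ _ _ _)

      *-distribˡ-sumL : ∀ (xs : List A) z (f : A → Carrier) → z * sumL xs f ≈ sumL xs (λ x → z * f x)
      *-distribˡ-sumL []       z f = zeroʳ z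
      *-distribˡ-sumL (x ∷ xs) z f = trans (distribˡ _ _ _) (+-cong refl (*-distribˡ-sumL xs z f))

      *-distribʳ-sumL : ∀ (xs : List A) z (f : A → Carrier) → sumL xs f * z ≈ sumL xs (λ x → f x * z)
      *-distribʳ-sumL []       z f = zeroˡ z
      *-distribʳ-sumL (x ∷ xs) z f = trans (distribʳ _ _ _) (+-cong refl (*-distribʳ-sumL xs z f))

      -‿distrib-sumL : ∀ (xs : List A) (f : A → Carrier) → - sumL xs f ≈ sumL xs (λ x → - f x)
      -‿distrib-sumL []       f = -0#≈0#
      -‿distrib-sumL (x ∷ xs) f = trans (sym (-‿+-comm _ _)) (+-cong refl (-‿distrib-sumL xs f))

      sumL-++ : ∀ (xs ys : List A) (f : A → Carrier) → sumL (xs ++L ys) f ≈ sumL xs f + sumL ys f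
      sumL-++ []       ys f = sym (+-identityˡ _)
      sumL-++ (x ∷ xs) ys f = trans (+-cong refl (sumL-++ xs ys f)) (sym (+-assoc _ _ _))

    sumL-map : ∀ {a b} {A : Set a} {B : Set b} (h : A → B) (xs : List A) (f : B → Carrier) →
               sumL (map h xs) f ≈ sumL xs (f ∘ h)
    sumL-map h []       f = refl
    sumL-map h (x ∷ xs) f = +-cong refl (sumL-map h xs f)

    sumL-swap : ∀ {a b} {A : Set a} {B : Set b} (xs : List A) (ys : List B) (F : A → B → Carrier) →
                sumL xs (λ x → sumL ys (F x)) ≈ sumL ys (λ y → sumL xs (λ x → F x y))
    sumL-swap []       ys F = sym (sumL-zero ys (λ _ → refl))
    sumL-swap (x ∷ xs) ys F = begin
      sumL ys (F x) + sumL xs (λ x → sumL ys (F x))          ≈⟨ +-cong refl (sumL-swap xs ys F) ⟩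
      sumL ys (F x) + sumL ys (λ y → sumL xs (λ x → F x y))  ≈⟨ sumL-+ ys _ _ ⟨
      sumL ys (λ y → F x y + sumL xs (λ x → F x y))          ∎

    ΣS : ∀ N → (Subset N → Carrier) → Carrier
    ΣS N = sumL (allSubsets N)

    ΣS-swap₃ : ∀ N M (F : Subset N → Subset N → Subset M → Carrier) →
      ΣS N (λ P → ΣS N (λ T → ΣS M (F P T))) ≈ ΣS M (λ S → ΣS N (λ P → ΣS N (λ T → F P T S)))
    ΣS-swap₃ N M F = trans (sumL-cong (allSubsets N) (λ P → sumL-swap (allSubsets N) (allSubsets M) (F P)))
                           (sumL-swap (allSubsets N) (allSubsets M) _)

    *-distribˡ-ΣS² : ∀ N z (F : Subset N → Subset N → Carrier) →
      z * ΣS N (λ P → ΣS N (F P)) ≈ ΣS N (λ P → ΣS N (λ T → z * F P T))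
    *-distribˡ-ΣS² N z F = trans (*-distribˡ-sumL (allSubsets N) z _)
                                 (sumL-cong (allSubsets N) (λ P → *-distribˡ-sumL (allSubsets N) z (F P)))

    ΣS-cong : ∀ N {f g : Subset N → Carrier} → (∀ S → f S ≈ g S) → ΣS N f ≈ ΣS N g
    ΣS-cong N = sumL-cong (allSubsets N)

    ΣS-split : ∀ N (f : Subset (suc N) → Carrier) →
      ΣS (suc N) f ≈ ΣS N (λ S → f (inside ∷ S)) + ΣS N (λ S → f (outside ∷ S))
    ΣS-split N f = trans (sumL-++ (map (inside ∷_) (allSubsets N)) _ f)
                         (+-cong (sumL-map _ (allSubsets N) f) (sumL-map _ (allSubsets N) f))

    ΣS-inside : ∀ N (F : Subset (suc N) → Carrier) → (∀ V → F (outside ∷ V) ≈ 0#) →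
      ΣS (suc N) F ≈ ΣS N (λ V → F (inside ∷ V))
    ΣS-inside N F q = trans (ΣS-split N F) (trans (+-cong refl (sumL-zero (allSubsets N) q)) (+-identityʳ _))

    ΣS-outside : ∀ N (F : Subset (suc N) → Carrier) → (∀ V → F (inside ∷ V) ≈ 0#) →
      ΣS (suc N) F ≈ ΣS N (λ V → F (outside ∷ V))
    ΣS-outside N F p = trans (ΣS-split N F) (trans (+-cong (sumL-zero (allSubsets N) p) refl) (+-identityˡ _))

    ΣS-suc-zero : ∀ N (F : Subset (suc N) → Carrier) →
      (∀ V → F (inside ∷ V) ≈ 0#) → (∀ V → F (outside ∷ V) ≈ 0#) → ΣS (suc N) F ≈ 0#
    ΣS-suc-zero N F p q = trans (ΣS-outside N F p) (sumL-zero (allSubsets N) q)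

    δ-sym : ∀ {N} (S U : Subset N) → δ S U ≡ δ U S
    δ-sym []            []            = ≡.refl
    δ-sym (inside ∷ S)  (inside ∷ U)  = δ-sym S U
    δ-sym (inside ∷ S)  (outside ∷ U) = ≡.refl
    δ-sym (outside ∷ S) (inside ∷ U)  = ≡.refl
    δ-sym (outside ∷ S) (outside ∷ U) = δ-sym S U

    ΣS-δˡ : ∀ N (U : Subset N) (h : Subset N → Carrier) → ΣS N (λ S → δ U S * h S) ≈ h U
    ΣS-δˡ zero    []            h = trans (+-identityʳ _) (*-identityˡ _)
    ΣS-δˡ (suc N) (inside ∷ U)  h =
      trans (ΣS-inside N _ (λ S → zeroˡ _)) (ΣS-δˡ N U (λ S → h (inside ∷ S)))
    ΣS-δˡ (suc N) (outside ∷ U) h =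
      trans (ΣS-outside N _ (λ S → zeroˡ _)) (ΣS-δˡ N U (λ S → h (outside ∷ S)))

    ΣS-δʳ : ∀ N (U : Subset N) (h : Subset N → Carrier) → ΣS N (λ S → h S * δ S U) ≈ h U
    ΣS-δʳ N U h = trans (ΣS-cong N (λ S → trans (*-comm _ _) (reflexive (≡.cong (_* h S) (δ-sym S U)))))
                        (ΣS-δˡ N U h)

    sign : ∀ {N} → Subset N → Carrier
    sign S = negPow ∣ S ∣

    negPow-square : ∀ m → negPow m * negPow m ≈ 1#
    negPow-square zero    = *-identityˡ _
    negPow-square (suc m) = begin
      - negPow m * - negPow m      ≈⟨ -‿distribˡ-* _ _ ⟨
      - (negPow m * - negPow m)    ≈⟨ -‿cong (-‿distribʳ-* _ _) ⟨
      - - (negPow m * negPow m)    ≈⟨ -‿involutive _ ⟩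
      negPow m * negPow m          ≈⟨ negPow-square m ⟩
      1#                           ∎

    sign-∅ : ∀ N → sign (∅ {N}) ≡ 1#
    sign-∅ N = ≡.cong negPow (∣⊥∣≡0 N)

    sign-⁅⁆ : ∀ {N} (a : Fin N) → sign ⁅ a ⁆ ≡ - 1#
    sign-⁅⁆ a = ≡.cong negPow (∣⁅x⁆∣≡1 a)

    sign-⁅⁆-* : ∀ {N} (a : Fin N) x → sign ⁅ a ⁆ * x ≈ - x
    sign-⁅⁆-* a x = trans (*-cong (reflexive (sign-⁅⁆ a)) refl) (-1*x≈-x x)

    wc-∅ˡ : ∀ {N} (T U : Subset N) → wc ∅ T U ≈ δ T U
    wc-∅ˡ []                     []            = refl
    wc-∅ˡ {suc N} (inside ∷ T)   (inside ∷ U)  =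
      trans (*-cong (reflexive (sign-∅ N)) (wc-∅ˡ T U)) (*-identityˡ _)
    wc-∅ˡ (inside ∷ T)           (outside ∷ U) = refl
    wc-∅ˡ (outside ∷ T)          (inside ∷ U)  = refl
    wc-∅ˡ (outside ∷ T)          (outside ∷ U) = wc-∅ˡ T U

    wc-∅ʳ : ∀ {N} (S U : Subset N) → wc S ∅ U ≈ δ S U
    wc-∅ʳ []            []            = refl
    wc-∅ʳ (inside ∷ S)  (inside ∷ U)  = wc-∅ʳ S U
    wc-∅ʳ (inside ∷ S)  (outside ∷ U) = refl
    wc-∅ʳ (outside ∷ S) (inside ∷ U)  = refl
    wc-∅ʳ (outside ∷ S) (outside ∷ U) = wc-∅ʳ S U

    wc-⁅⁆-square : ∀ {N} (a : Fin N) U → wc ⁅ a ⁆ ⁅ a ⁆ U ≈ 0#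
    wc-⁅⁆-square zero    U             = refl
    wc-⁅⁆-square (suc a) (inside ∷ U)  = refl
    wc-⁅⁆-square (suc a) (outside ∷ U) = wc-⁅⁆-square a U

    wc-⁅⁆-anticomm : ∀ {N} (a b : Fin N) U → wc ⁅ a ⁆ ⁅ b ⁆ U ≈ - wc ⁅ b ⁆ ⁅ a ⁆ U
    wc-⁅⁆-anticomm zero    zero    U             = sym -0#≈0#
    wc-⁅⁆-anticomm zero    (suc b) (inside ∷ U)  = begin
      wc ∅ ⁅ b ⁆ U                ≈⟨ wc-∅ˡ ⁅ b ⁆ U ⟩
      δ ⁅ b ⁆ U                   ≈⟨ wc-∅ʳ ⁅ b ⁆ U ⟨
      wc ⁅ b ⁆ ∅ U                ≈⟨ -‿involutive _ ⟨
      - - wc ⁅ b ⁆ ∅ U            ≈⟨ -‿cong (sign-⁅⁆-* b _) ⟨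
      - (sign ⁅ b ⁆ * wc ⁅ b ⁆ ∅ U) ∎
    wc-⁅⁆-anticomm zero    (suc b) (outside ∷ U) = sym -0#≈0#
    wc-⁅⁆-anticomm (suc a) zero    (inside ∷ U)  = begin
      sign ⁅ a ⁆ * wc ⁅ a ⁆ ∅ U   ≈⟨ sign-⁅⁆-* a _ ⟩
      - wc ⁅ a ⁆ ∅ U              ≈⟨ -‿cong (trans (wc-∅ʳ ⁅ a ⁆ U) (sym (wc-∅ˡ ⁅ a ⁆ U))) ⟩
      - wc ∅ ⁅ a ⁆ U              ∎
    wc-⁅⁆-anticomm (suc a) zero    (outside ∷ U) = sym -0#≈0#
    wc-⁅⁆-anticomm (suc a) (suc b) (inside ∷ U)  = sym -0#≈0#
    wc-⁅⁆-anticomm (suc a) (suc b) (outside ∷ U) = wc-⁅⁆-anticomm a b U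

    -- wc S T V vanishes unless V is the disjoint union of S and T, so that |V| = |S| + |T|
    wc-sign : ∀ {N} (S T V : Subset N) → wc S T V * sign V ≈ (sign S * sign T) * wc S T V
    wc-sign []            []            []            =
      trans (*-identityˡ _) (sym (trans (*-identityʳ _) (*-identityˡ _)))
    wc-sign (inside ∷ S)  (inside ∷ T)  V             = trans (zeroˡ _) (sym (zeroʳ _))
    wc-sign (inside ∷ S)  (outside ∷ T) (inside ∷ V)  = begin
      wc S T V * - sign V                ≈⟨ -‿distribʳ-* _ _ ⟨
      - (wc S T V * sign V)              ≈⟨ -‿cong (wc-sign S T V) ⟩
      - ((sign S * sign T) * wc S T V)   ≈⟨ -‿distribˡ-* _ _ ⟩
      - (sign S * sign T) * wc S T V     ≈⟨ *-cong (-‿distribˡ-* _ _) refl ⟩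
      (- sign S * sign T) * wc S T V     ∎
    wc-sign (inside ∷ S)  (outside ∷ T) (outside ∷ V) = trans (zeroˡ _) (sym (zeroʳ _))
    wc-sign (outside ∷ S) (inside ∷ T)  (inside ∷ V)  = begin
      (sign S * wc S T V) * - sign V                  ≈⟨ -‿distribʳ-* _ _ ⟨
      - ((sign S * wc S T V) * sign V)                ≈⟨ -‿cong (*-assoc _ _ _) ⟩
      - (sign S * (wc S T V * sign V))                ≈⟨ -‿cong (*-cong refl (wc-sign S T V)) ⟩
      - (sign S * ((sign S * sign T) * wc S T V))     ≈⟨ -‿cong (*-cong refl (*-assoc _ _ _)) ⟩
      - (sign S * (sign S * (sign T * wc S T V)))     ≈⟨ -‿cong (*-cong refl (x∙yz≈y∙xz _ _ _)) ⟩
      - (sign S * (sign T * (sign S * wc S T V)))     ≈⟨ -‿cong (*-assoc _ _ _) ⟨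
      - ((sign S * sign T) * (sign S * wc S T V))     ≈⟨ -‿distribˡ-* _ _ ⟩
      - (sign S * sign T) * (sign S * wc S T V)       ≈⟨ *-cong (-‿distribʳ-* _ _) refl ⟩
      (sign S * - sign T) * (sign S * wc S T V)       ∎
    wc-sign (outside ∷ S) (inside ∷ T)  (outside ∷ V) = trans (zeroˡ _) (sym (zeroʳ _))
    wc-sign (outside ∷ S) (outside ∷ T) (inside ∷ V)  = trans (zeroˡ _) (sym (zeroʳ _))
    wc-sign (outside ∷ S) (outside ∷ T) (outside ∷ V) = wc-sign S T V

    wc-assoc : ∀ N (S T R U : Subset N) →
      ΣS N (λ V → wc S T V * wc V R U) ≈ ΣS N (λ V → wc T R V * wc S V U)
    wc-assoc zero    [] [] [] [] = refl
    wc-assoc (suc N) (outside ∷ S) (outside ∷ T) (outside ∷ R) (outside ∷ U) =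
      trans (ΣS-outside N _ (λ V → zeroˡ _)) (trans (wc-assoc N S T R U) (sym (ΣS-outside N _ (λ V → zeroˡ _))))
    wc-assoc (suc N) (inside ∷ S) (outside ∷ T) (outside ∷ R) (inside ∷ U) =
      trans (ΣS-inside N _ (λ V → zeroˡ _)) (trans (wc-assoc N S T R U) (sym (ΣS-outside N _ (λ V → zeroˡ _))))
    wc-assoc (suc N) (outside ∷ S) (inside ∷ T) (outside ∷ R) (inside ∷ U) = begin
      ΣS (suc N) _                                        ≈⟨ ΣS-inside N _ (λ V → zeroˡ _) ⟩
      ΣS N (λ V → (sign S * wc S T V) * wc V R U)         ≈⟨ ΣS-cong N (λ V → *-assoc _ _ _) ⟩
      ΣS N (λ V → sign S * (wc S T V * wc V R U))         ≈⟨ *-distribˡ-sumL (allSubsets N) _ _ ⟨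
      sign S * ΣS N (λ V → wc S T V * wc V R U)           ≈⟨ *-cong refl (wc-assoc N S T R U) ⟩
      sign S * ΣS N (λ V → wc T R V * wc S V U)           ≈⟨ *-distribˡ-sumL (allSubsets N) _ _ ⟩
      ΣS N (λ V → sign S * (wc T R V * wc S V U))         ≈⟨ ΣS-cong N (λ V → x∙yz≈y∙xz _ _ _) ⟩
      ΣS N (λ V → wc T R V * (sign S * wc S V U))         ≈⟨ ΣS-inside N _ (λ V → zeroˡ _) ⟨
      ΣS (suc N) _                                        ∎
    wc-assoc (suc N) (outside ∷ S) (outside ∷ T) (inside ∷ R) (inside ∷ U) = begin
      ΣS (suc N) _                                        ≈⟨ ΣS-outside N _ (λ V → zeroˡ _) ⟩
      ΣS N (λ V → wc S T V * (sign V * wc V R U))         ≈⟨ ΣS-cong N (λ V → regroup V) ⟩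
      ΣS N (λ V → (sign S * sign T) * (wc S T V * wc V R U)) ≈⟨ *-distribˡ-sumL (allSubsets N) _ _ ⟨
      (sign S * sign T) * ΣS N (λ V → wc S T V * wc V R U)   ≈⟨ *-cong refl (wc-assoc N S T R U) ⟩
      (sign S * sign T) * ΣS N (λ V → wc T R V * wc S V U)   ≈⟨ *-distribˡ-sumL (allSubsets N) _ _ ⟩
      ΣS N (λ V → (sign S * sign T) * (wc T R V * wc S V U)) ≈⟨ ΣS-cong N (λ V → trans (*-cong (*-comm _ _) refl) (interchange _ _ _ _)) ⟩
      ΣS N (λ V → (sign T * wc T R V) * (sign S * wc S V U)) ≈⟨ ΣS-inside N _ (λ V → zeroˡ _) ⟨
      ΣS (suc N) _                                        ∎
      where
      regroup : ∀ V → wc S T V * (sign V * wc V R U) ≈ (sign S * sign T) * (wc S T V * wc V R U)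
      regroup V = trans (sym (*-assoc _ _ _)) (trans (*-cong (wc-sign S T V) refl) (*-assoc _ _ _))
    wc-assoc (suc N) (inside ∷ S) (inside ∷ T) (inside ∷ R) (inside ∷ U) =
      trans (ΣS-suc-zero N _ (λ V → zeroˡ _) (λ V → zeroˡ _)) (sym (ΣS-suc-zero N _ (λ V → zeroˡ _) (λ V → zeroˡ _)))
    wc-assoc (suc N) (inside ∷ S) (inside ∷ T) (inside ∷ R) (outside ∷ U) =
      trans (ΣS-suc-zero N _ (λ V → zeroˡ _) (λ V → zeroˡ _)) (sym (ΣS-suc-zero N _ (λ V → zeroˡ _) (λ V → zeroˡ _)))
    wc-assoc (suc N) (inside ∷ S) (inside ∷ T) (outside ∷ R) (inside ∷ U) =
      trans (ΣS-suc-zero N _ (λ V → zeroˡ _) (λ V → zeroˡ _)) (sym (ΣS-suc-zero N _ (λ V → zeroʳ _) (λ V → zeroˡ _)))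
    wc-assoc (suc N) (inside ∷ S) (inside ∷ T) (outside ∷ R) (outside ∷ U) =
      trans (ΣS-suc-zero N _ (λ V → zeroˡ _) (λ V → zeroˡ _)) (sym (ΣS-suc-zero N _ (λ V → zeroʳ _) (λ V → zeroˡ _)))
    wc-assoc (suc N) (inside ∷ S) (outside ∷ T) (inside ∷ R) (inside ∷ U) =
      trans (ΣS-suc-zero N _ (λ V → zeroʳ _) (λ V → zeroˡ _)) (sym (ΣS-suc-zero N _ (λ V → zeroʳ _) (λ V → zeroˡ _)))
    wc-assoc (suc N) (inside ∷ S) (outside ∷ T) (inside ∷ R) (outside ∷ U) =
      trans (ΣS-suc-zero N _ (λ V → zeroʳ _) (λ V → zeroˡ _)) (sym (ΣS-suc-zero N _ (λ V → zeroʳ _) (λ V → zeroˡ _)))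
    wc-assoc (suc N) (inside ∷ S) (outside ∷ T) (outside ∷ R) (outside ∷ U) =
      trans (ΣS-suc-zero N _ (λ V → zeroʳ _) (λ V → zeroˡ _)) (sym (ΣS-suc-zero N _ (λ V → zeroˡ _) (λ V → zeroʳ _)))
    wc-assoc (suc N) (outside ∷ S) (inside ∷ T) (inside ∷ R) (inside ∷ U) =
      trans (ΣS-suc-zero N _ (λ V → zeroʳ _) (λ V → zeroˡ _)) (sym (ΣS-suc-zero N _ (λ V → zeroˡ _) (λ V → zeroˡ _)))
    wc-assoc (suc N) (outside ∷ S) (inside ∷ T) (inside ∷ R) (outside ∷ U) =
      trans (ΣS-suc-zero N _ (λ V → zeroʳ _) (λ V → zeroˡ _)) (sym (ΣS-suc-zero N _ (λ V → zeroˡ _) (λ V → zeroˡ _)))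
    wc-assoc (suc N) (outside ∷ S) (inside ∷ T) (outside ∷ R) (outside ∷ U) =
      trans (ΣS-suc-zero N _ (λ V → zeroʳ _) (λ V → zeroˡ _)) (sym (ΣS-suc-zero N _ (λ V → zeroʳ _) (λ V → zeroˡ _)))
    wc-assoc (suc N) (outside ∷ S) (outside ∷ T) (inside ∷ R) (outside ∷ U) =
      trans (ΣS-suc-zero N _ (λ V → zeroˡ _) (λ V → zeroʳ _)) (sym (ΣS-suc-zero N _ (λ V → zeroʳ _) (λ V → zeroˡ _)))
    wc-assoc (suc N) (outside ∷ S) (outside ∷ T) (outside ∷ R) (inside ∷ U) =
      trans (ΣS-suc-zero N _ (λ V → zeroˡ _) (λ V → zeroʳ _)) (sym (ΣS-suc-zero N _ (λ V → zeroˡ _) (λ V → zeroʳ _)))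

    ∂e-wc-⁅zero⁆ : ∀ N (T U : Subset (suc N)) →
      ΣS (suc N) (λ V → wc ⁅ zero ⁆ T V * ∂e V U) ≈ δ T U + - ΣS (suc N) (λ W → ∂e T W * wc ⁅ zero ⁆ W U)
    ∂e-wc-⁅zero⁆ N (inside ∷ T) (inside ∷ U) = begin
      ΣS (suc N) (λ V → wc ⁅ zero ⁆ (inside ∷ T) V * ∂e V (inside ∷ U))  ≈⟨ sumL-zero (allSubsets (suc N)) (λ V → zeroˡ _) ⟩
      0#                                                   ≈⟨ -‿inverseʳ _ ⟨
      δ T U + - δ T U                                      ≈⟨ +-cong refl (-‿cong (ΣS-δˡ N T _)) ⟨
      δ T U + - ΣS N (λ W → δ T W * δ W U)                 ≈⟨ +-cong refl (-‿cong (ΣS-cong N (λ W → *-cong refl (wc-∅ˡ W U)))) ⟨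
      δ T U + - ΣS N (λ W → δ T W * wc ∅ W U)              ≈⟨ +-cong refl (-‿cong (ΣS-outside N _ (λ W → zeroʳ _))) ⟨
      δ T U + - ΣS (suc N) (λ W → ∂e (inside ∷ T) W * wc ⁅ zero ⁆ W (inside ∷ U)) ∎
    ∂e-wc-⁅zero⁆ N (inside ∷ T) (outside ∷ U) = begin
      ΣS (suc N) (λ V → wc ⁅ zero ⁆ (inside ∷ T) V * ∂e V (outside ∷ U)) ≈⟨ sumL-zero (allSubsets (suc N)) (λ V → zeroˡ _) ⟩
      0#
        ≈⟨ trans (+-cong refl (-‿cong (ΣS-suc-zero N _ (λ W → zeroʳ _) (λ W → zeroʳ _)))) (trans (+-identityˡ _) -0#≈0#) ⟨
      0# + - ΣS (suc N) (λ W → ∂e (inside ∷ T) W * wc ⁅ zero ⁆ W (outside ∷ U)) ∎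
    ∂e-wc-⁅zero⁆ N (outside ∷ T) (inside ∷ U) = begin
      ΣS (suc N) (λ V → wc ⁅ zero ⁆ (outside ∷ T) V * ∂e V (inside ∷ U)) ≈⟨ ΣS-inside N _ (λ V → zeroˡ _) ⟩
      ΣS N (λ V → wc ∅ T V * - ∂e V U)                     ≈⟨ ΣS-cong N (λ V → *-cong (wc-∅ˡ T V) refl) ⟩
      ΣS N (λ V → δ T V * - ∂e V U)                        ≈⟨ ΣS-δˡ N T _ ⟩
      - ∂e T U                                             ≈⟨ +-identityˡ _ ⟨
      0# + - ∂e T U                                        ≈⟨ +-cong refl (-‿cong (ΣS-δʳ N U _)) ⟨
      0# + - ΣS N (λ W → ∂e T W * δ W U)                   ≈⟨ +-cong refl (-‿cong (ΣS-cong N (λ W → *-cong refl (wc-∅ˡ W U)))) ⟨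
      0# + - ΣS N (λ W → ∂e T W * wc ∅ W U)                ≈⟨ +-cong refl (-‿cong (ΣS-outside N _ (λ W → zeroˡ _))) ⟨
      0# + - ΣS (suc N) (λ W → ∂e (outside ∷ T) W * wc ⁅ zero ⁆ W (inside ∷ U)) ∎
    ∂e-wc-⁅zero⁆ N (outside ∷ T) (outside ∷ U) = begin
      ΣS (suc N) (λ V → wc ⁅ zero ⁆ (outside ∷ T) V * ∂e V (outside ∷ U)) ≈⟨ ΣS-inside N _ (λ V → zeroˡ _) ⟩
      ΣS N (λ V → wc ∅ T V * δ V U)                        ≈⟨ ΣS-cong N (λ V → *-cong (wc-∅ˡ T V) refl) ⟩
      ΣS N (λ V → δ T V * δ V U)                           ≈⟨ ΣS-δˡ N T _ ⟩
      δ T U                                                ≈⟨ +-identityʳ _ ⟨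
      δ T U + 0#                                           ≈⟨ +-cong refl (trans (-‿cong (ΣS-suc-zero N _ (λ W → zeroˡ _) (λ W → zeroʳ _))) -0#≈0#) ⟨
      δ T U + - ΣS (suc N) (λ W → ∂e (outside ∷ T) W * wc ⁅ zero ⁆ W (outside ∷ U)) ∎

    -- the coefficient form of ∂ (e_a e_T) = e_T - e_a ∂ e_T
    ∂e-wc-⁅⁆ : ∀ N (a : Fin N) (T U : Subset N) →
      ΣS N (λ V → wc ⁅ a ⁆ T V * ∂e V U) ≈ δ T U + - ΣS N (λ W → ∂e T W * wc ⁅ a ⁆ W U)
    ∂e-wc-⁅⁆ (suc N) zero T U = ∂e-wc-⁅zero⁆ N T U
    ∂e-wc-⁅⁆ (suc N) (suc a) (inside ∷ T) (inside ∷ U) = begin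
      ΣS (suc N) (λ V → wc ⁅ suc a ⁆ (inside ∷ T) V * ∂e V (inside ∷ U)) ≈⟨ ΣS-inside N _ (λ V → zeroˡ _) ⟩
      ΣS N (λ V → (sign ⁅ a ⁆ * wc ⁅ a ⁆ T V) * - ∂e V U)  ≈⟨ ΣS-cong N (λ V → sign-cancel _ _) ⟩
      ΣS N (λ V → wc ⁅ a ⁆ T V * ∂e V U)                   ≈⟨ ∂e-wc-⁅⁆ N a T U ⟩
      δ T U + - ΣS N (λ W → ∂e T W * wc ⁅ a ⁆ W U)
        ≈⟨ +-cong refl (-‿cong (ΣS-cong N (λ W → trans (*-comm _ _) (trans (sign-cancel _ _) (*-comm _ _))))) ⟨
      δ T U + - ΣS N (λ W → - ∂e T W * (sign ⁅ a ⁆ * wc ⁅ a ⁆ W U)) ≈⟨ +-cong refl (-‿cong (ΣS-inside N _ (λ W → zeroʳ _))) ⟨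
      δ T U + - ΣS (suc N) (λ W → ∂e (inside ∷ T) W * wc ⁅ suc a ⁆ W (inside ∷ U)) ∎
      where
      sign-cancel : ∀ x y → (sign ⁅ a ⁆ * x) * - y ≈ x * y
      sign-cancel x y = begin
        (sign ⁅ a ⁆ * x) * - y   ≈⟨ *-cong (sign-⁅⁆-* a x) refl ⟩
        - x * - y                ≈⟨ -‿distribˡ-* _ _ ⟨
        - (x * - y)              ≈⟨ -‿cong (-‿distribʳ-* _ _) ⟨
        - - (x * y)              ≈⟨ -‿involutive _ ⟩
        x * y                    ∎
    ∂e-wc-⁅⁆ (suc N) (suc a) (inside ∷ T) (outside ∷ U) = begin
      ΣS (suc N) (λ V → wc ⁅ suc a ⁆ (inside ∷ T) V * ∂e V (outside ∷ U)) ≈⟨ ΣS-inside N _ (λ V → zeroˡ _) ⟩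
      ΣS N (λ V → (sign ⁅ a ⁆ * wc ⁅ a ⁆ T V) * δ V U)     ≈⟨ ΣS-δʳ N U _ ⟩
      sign ⁅ a ⁆ * wc ⁅ a ⁆ T U                            ≈⟨ sign-⁅⁆-* a _ ⟩
      - wc ⁅ a ⁆ T U                                       ≈⟨ +-identityˡ _ ⟨
      0# + - wc ⁅ a ⁆ T U                                  ≈⟨ +-cong refl (-‿cong (ΣS-δˡ N T _)) ⟨
      0# + - ΣS N (λ W → δ T W * wc ⁅ a ⁆ W U)             ≈⟨ +-cong refl (-‿cong (ΣS-outside N _ (λ W → zeroʳ _))) ⟨
      0# + - ΣS (suc N) (λ W → ∂e (inside ∷ T) W * wc ⁅ suc a ⁆ W (outside ∷ U)) ∎
    ∂e-wc-⁅⁆ (suc N) (suc a) (outside ∷ T) (inside ∷ U) = begin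
      ΣS (suc N) (λ V → wc ⁅ suc a ⁆ (outside ∷ T) V * ∂e V (inside ∷ U)) ≈⟨ ΣS-suc-zero N _ (λ V → zeroˡ _) (λ V → zeroʳ _) ⟩
      0#
        ≈⟨ trans (+-cong refl (-‿cong (ΣS-suc-zero N _ (λ W → zeroˡ _) (λ W → zeroʳ _)))) (trans (+-identityˡ _) -0#≈0#) ⟨
      0# + - ΣS (suc N) (λ W → ∂e (outside ∷ T) W * wc ⁅ suc a ⁆ W (inside ∷ U)) ∎
    ∂e-wc-⁅⁆ (suc N) (suc a) (outside ∷ T) (outside ∷ U) = begin
      ΣS (suc N) (λ V → wc ⁅ suc a ⁆ (outside ∷ T) V * ∂e V (outside ∷ U)) ≈⟨ ΣS-outside N _ (λ V → zeroˡ _) ⟩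
      ΣS N (λ V → wc ⁅ a ⁆ T V * ∂e V U)                   ≈⟨ ∂e-wc-⁅⁆ N a T U ⟩
      δ T U + - ΣS N (λ W → ∂e T W * wc ⁅ a ⁆ W U)         ≈⟨ +-cong refl (-‿cong (ΣS-outside N _ (λ W → zeroˡ _))) ⟨
      δ T U + - ΣS (suc N) (λ W → ∂e (outside ∷ T) W * wc ⁅ suc a ⁆ W (outside ∷ U)) ∎

  open Coefficients public

  ΛSetoid : ℕ → Setoid c ℓ
  ΛSetoid N = record
    { Carrier       = Λ N
    ; _≈_           = _≈Λ_
    ; isEquivalence = record
      { refl  = λ _ → refl
      ; sym   = λ p U → sym (p U)
      ; trans = λ p q U → trans (p U) (q U)
      }
    }

  module ΛReasoning {N : ℕ} = SetoidReasoning (ΛSetoid N)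

  module _ {N : ℕ} where
    open Setoid (ΛSetoid N) public
      using () renaming (refl to ≈Λ-refl; sym to ≈Λ-sym; trans to ≈Λ-trans; reflexive to ≈Λ-reflexive)

  infixr 25 _·_
  _·_ : ∀ {N} → Carrier → Λ N → Λ N
  (z · f) U = z * f U

  module _ {N : ℕ} where
    +Λ-cong : {a a' b b' : Λ N} → a ≈Λ a' → b ≈Λ b' → (a +Λ b) ≈Λ (a' +Λ b')
    +Λ-cong p q U = +-cong (p U) (q U)

    -Λ-cong : {a a' : Λ N} → a ≈Λ a' → (-Λ a) ≈Λ (-Λ a')
    -Λ-cong p U = -‿cong (p U)

    ·-cong : ∀ {z z'} {a a' : Λ N} → z ≈ z' → a ≈Λ a' → (z · a) ≈Λ (z' · a')
    ·-cong p q U = *-cong p (q U)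

    +Λ-identityˡ : (a : Λ N) → (0Λ +Λ a) ≈Λ a
    +Λ-identityˡ a U = +-identityˡ _

    +Λ-identityʳ : (a : Λ N) → (a +Λ 0Λ) ≈Λ a
    +Λ-identityʳ a U = +-identityʳ _

    +Λ-comm : (a b : Λ N) → (a +Λ b) ≈Λ (b +Λ a)
    +Λ-comm a b U = +-comm _ _

    +Λ-interchange : (a b d e : Λ N) → ((a +Λ b) +Λ (d +Λ e)) ≈Λ ((a +Λ d) +Λ (b +Λ e))
    +Λ-interchange a b d e U = +-interchange _ _ _ _

    +Λ-inverseʳ : (a : Λ N) → (a +Λ (-Λ a)) ≈Λ 0Λ
    +Λ-inverseʳ a U = -‿inverseʳ _

    -Λ-zero : (-Λ 0Λ {N}) ≈Λ 0Λ
    -Λ-zero U = -0#≈0#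

    -Λ-involutive : (a : Λ N) → (-Λ (-Λ a)) ≈Λ a
    -Λ-involutive a U = -‿involutive _

    -Λ-distrib-+Λ : (a b : Λ N) → (-Λ (a +Λ b)) ≈Λ ((-Λ a) +Λ (-Λ b))
    -Λ-distrib-+Λ a b U = sym (-‿+-comm _ _)

    -Λ≈-1· : (a : Λ N) → (-Λ a) ≈Λ ((- 1#) · a)
    -Λ≈-1· a U = sym (-1*x≈-x _)

    -Λ-· : ∀ z (a : Λ N) → (-Λ (z · a)) ≈Λ ((- z) · a)
    -Λ-· z a U = -‿distribˡ-* _ _

    ·-neg : ∀ z (a : Λ N) → (z · (-Λ a)) ≈Λ ((- z) · a)
    ·-neg z a U = trans (sym (-‿distribʳ-* _ _)) (-‿distribˡ-* _ _)

    ·-assoc : ∀ z w (a : Λ N) → (z · (w · a)) ≈Λ ((z * w) · a)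
    ·-assoc z w a U = sym (*-assoc _ _ _)

    ·-identityˡ : (a : Λ N) → (1# · a) ≈Λ a
    ·-identityˡ a U = *-identityˡ _

    ·-zeroˡ : (a : Λ N) → (0# · a) ≈Λ 0Λ
    ·-zeroˡ a U = zeroˡ _

    ·-zeroʳ : ∀ z → (z · 0Λ {N}) ≈Λ 0Λ
    ·-zeroʳ z U = zeroʳ z

    ·-distribʳ : ∀ x y (a : Λ N) → ((x + y) · a) ≈Λ ((x · a) +Λ (y · a))
    ·-distribʳ x y a U = distribʳ _ _ _

  -- Opaque, so that linComb f Y stays rigid and f and Y can be inferred by unification.
  opaque
    linComb : ∀ {N L} → (Subset N → Carrier) → (Subset N → Λ L) → Λ L
    linComb {N} f Y U = ΣS N (λ S → f S * Y S U)

  module Coefficientwise where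
    open SetoidReasoning setoid

    opaque
      unfolding linComb

      linComb-cong : ∀ {N L} {f f' : Subset N → Carrier} {Y Y' : Subset N → Λ L} →
        (∀ S → f S ≈ f' S) → (∀ S → Y S ≈Λ Y' S) → linComb f Y ≈Λ linComb f' Y'
      linComb-cong {N} p q U = ΣS-cong N (λ S → *-cong (p S) (q S U))

      linComb-split : ∀ {N L} (f : Subset (suc N) → Carrier) (Y : Subset (suc N) → Λ L) →
        linComb f Y ≈Λ (linComb (λ S → f (inside ∷ S)) (λ S → Y (inside ∷ S))
                         +Λ linComb (λ S → f (outside ∷ S)) (λ S → Y (outside ∷ S)))
      linComb-split {N} f Y U = ΣS-split N _

      linComb-zero : ∀ {N L} (f : Subset N → Carrier) (Y : Subset N → Λ L) →
        (∀ S → f S ≈ 0#) → linComb f Y ≈Λ 0Λ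
      linComb-zero {N} f Y p U = sumL-zero (allSubsets N) (λ S → trans (*-cong (p S) refl) (zeroˡ _))

      linComb-empty : ∀ {L} (f : Subset 0 → Carrier) (Y : Subset 0 → Λ L) → linComb f Y ≈Λ (f [] · Y [])
      linComb-empty f Y U = +-identityʳ _

      linComb-· : ∀ {N L} z (f : Subset N → Carrier) (Y : Subset N → Λ L) →
        linComb (λ S → z * f S) Y ≈Λ z · linComb f Y
      linComb-· {N} z f Y U =
        sym (trans (*-distribˡ-sumL (allSubsets N) z _) (ΣS-cong N (λ S → sym (*-assoc _ _ _))))

      linComb-+ˡ : ∀ {N L} (f f' : Subset N → Carrier) (Y : Subset N → Λ L) →
        linComb (f +Λ f') Y ≈Λ (linComb f Y +Λ linComb f' Y)
      linComb-+ˡ {N} f f' Y U = trans (ΣS-cong N (λ S → distribʳ _ _ _)) (sumL-+ (allSubsets N) _ _)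

      linComb-+ʳ : ∀ {N L} (f : Subset N → Carrier) (Y Z : Subset N → Λ L) →
        linComb f (λ T → Y T +Λ Z T) ≈Λ (linComb f Y +Λ linComb f Z)
      linComb-+ʳ {N} f Y Z U = trans (ΣS-cong N (λ S → distribˡ _ _ _)) (sumL-+ (allSubsets N) _ _)

      linComb-negˡ : ∀ {N L} (f : Subset N → Carrier) (Y : Subset N → Λ L) →
        linComb (-Λ f) Y ≈Λ (-Λ linComb f Y)
      linComb-negˡ {N} f Y U =
        trans (ΣS-cong N (λ S → sym (-‿distribˡ-* _ _))) (sym (-‿distrib-sumL (allSubsets N) _))

      linComb-negʳ : ∀ {N L} (f : Subset N → Carrier) (Y : Subset N → Λ L) →
        linComb f (λ T → -Λ Y T) ≈Λ (-Λ linComb f Y)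
      linComb-negʳ {N} f Y U =
        trans (ΣS-cong N (λ S → sym (-‿distribʳ-* _ _))) (sym (-‿distrib-sumL (allSubsets N) _))

      linComb-assoc : ∀ {N M L} (f : Subset N → Carrier) (Y : Subset N → Λ M) (Z : Subset M → Λ L) →
        linComb (linComb f Y) Z ≈Λ linComb f (λ S → linComb (Y S) Z)
      linComb-assoc {N} {M} f Y Z U = begin
        ΣS M (λ T → ΣS N (λ S → f S * Y S T) * Z T U)     ≈⟨ ΣS-cong M (λ T → *-distribʳ-sumL (allSubsets N) _ _) ⟩
        ΣS M (λ T → ΣS N (λ S → (f S * Y S T) * Z T U))   ≈⟨ sumL-swap (allSubsets M) (allSubsets N) _ ⟩
        ΣS N (λ S → ΣS M (λ T → (f S * Y S T) * Z T U))   ≈⟨ ΣS-cong N (λ S → ΣS-cong M (λ T → *-assoc _ _ _)) ⟩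
        ΣS N (λ S → ΣS M (λ T → f S * (Y S T * Z T U)))   ≈⟨ ΣS-cong N (λ S → *-distribˡ-sumL (allSubsets M) _ _) ⟨
        ΣS N (λ S → f S * ΣS M (λ T → Y S T * Z T U))     ∎

      linComb-δ : ∀ {N L} (S : Subset N) (Y : Subset N → Λ L) → linComb (basis S) Y ≈Λ Y S
      linComb-δ {N} S Y U = ΣS-δˡ N S (λ T → Y T U)

      linComb-basis : ∀ {N} (a : Λ N) → linComb a basis ≈Λ a
      linComb-basis {N} a U = ΣS-δʳ N U a

      linComb-wc-assoc : ∀ {N} (S T R : Subset N) →
        linComb (wc S T) (λ V → wc V R) ≈Λ linComb (wc T R) (wc S)
      linComb-wc-assoc {N} S T R U = wc-assoc N S T R U

      extHom≈linComb : ∀ {N L} (g : Fin N → Λ L) (f : Λ N) → extHom g f ≈Λ linComb f (mono g)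
      extHom≈linComb g f U = refl

      ∧-linCombˡ : ∀ {M N} (f : Subset M → Carrier) (Y : Subset M → Λ N) (b : Λ N) →
        (linComb f Y ∧ b) ≈Λ linComb f (λ S → Y S ∧ b)
      ∧-linCombˡ {M} {N} f Y b U = begin
        ΣS N (λ P → ΣS N (λ T → (ΣS M (λ S → f S * Y S P) * b T) * wc P T U))
          ≈⟨ ΣS-cong N (λ P → ΣS-cong N (λ T → pull P T)) ⟩
        ΣS N (λ P → ΣS N (λ T → ΣS M (λ S → f S * ((Y S P * b T) * wc P T U))))
          ≈⟨ ΣS-swap₃ N M _ ⟩
        ΣS M (λ S → ΣS N (λ P → ΣS N (λ T → f S * ((Y S P * b T) * wc P T U))))
          ≈⟨ ΣS-cong M (λ S → *-distribˡ-ΣS² N (f S) _) ⟨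
        ΣS M (λ S → f S * ΣS N (λ P → ΣS N (λ T → (Y S P * b T) * wc P T U))) ∎
        where
        pull : ∀ P T → (ΣS M (λ S → f S * Y S P) * b T) * wc P T U ≈ ΣS M (λ S → f S * ((Y S P * b T) * wc P T U))
        pull P T = trans (*-cong (*-distribʳ-sumL (allSubsets M) _ _) refl) (trans (*-distribʳ-sumL (allSubsets M) _ _)
          (ΣS-cong M (λ S → trans (*-cong (*-assoc _ _ _) refl) (*-assoc _ _ _))))

      ∧-linCombʳ : ∀ {M N} (a : Λ N) (f : Subset M → Carrier) (Y : Subset M → Λ N) →
        (a ∧ linComb f Y) ≈Λ linComb f (λ S → a ∧ Y S)
      ∧-linCombʳ {M} {N} a f Y U = begin
        ΣS N (λ P → ΣS N (λ T → (a P * ΣS M (λ S → f S * Y S T)) * wc P T U))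
          ≈⟨ ΣS-cong N (λ P → ΣS-cong N (λ T → pull P T)) ⟩
        ΣS N (λ P → ΣS N (λ T → ΣS M (λ S → f S * ((a P * Y S T) * wc P T U))))
          ≈⟨ ΣS-swap₃ N M _ ⟩
        ΣS M (λ S → ΣS N (λ P → ΣS N (λ T → f S * ((a P * Y S T) * wc P T U))))
          ≈⟨ ΣS-cong M (λ S → *-distribˡ-ΣS² N (f S) _) ⟨
        ΣS M (λ S → f S * ΣS N (λ P → ΣS N (λ T → (a P * Y S T) * wc P T U))) ∎
        where
        pull : ∀ P T → (a P * ΣS M (λ S → f S * Y S T)) * wc P T U ≈ ΣS M (λ S → f S * ((a P * Y S T) * wc P T U))
        pull P T = trans (*-cong (*-distribˡ-sumL (allSubsets M) _ _) refl) (trans (*-distribʳ-sumL (allSubsets M) _ _)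
          (ΣS-cong M (λ S → trans (*-cong (x∙yz≈y∙xz _ _ _) refl) (*-assoc _ _ _))))

    module _ {N : ℕ} where
      ∧-cong : {a a' b b' : Λ N} → a ≈Λ a' → b ≈Λ b' → (a ∧ b) ≈Λ (a' ∧ b')
      ∧-cong p q U = ΣS-cong N (λ S → ΣS-cong N (λ T → *-cong (*-cong (p S) (q T)) refl))

      ∧-distribʳ-+Λ : (a b d : Λ N) → ((a +Λ b) ∧ d) ≈Λ ((a ∧ d) +Λ (b ∧ d))
      ∧-distribʳ-+Λ a b d U = trans (ΣS-cong N (λ P → trans (ΣS-cong N (λ T →
          trans (*-cong (distribʳ _ _ _) refl) (distribʳ _ _ _))) (sumL-+ (allSubsets N) _ _)))
        (sumL-+ (allSubsets N) _ _)

      ∧-distribˡ-+Λ : (a b d : Λ N) → (d ∧ (a +Λ b)) ≈Λ ((d ∧ a) +Λ (d ∧ b))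
      ∧-distribˡ-+Λ a b d U = trans (ΣS-cong N (λ P → trans (ΣS-cong N (λ T →
          trans (*-cong (distribˡ _ _ _) refl) (distribʳ _ _ _))) (sumL-+ (allSubsets N) _ _)))
        (sumL-+ (allSubsets N) _ _)

      ∧-·ˡ : ∀ z (a b : Λ N) → ((z · a) ∧ b) ≈Λ (z · (a ∧ b))
      ∧-·ˡ z a b U = sym (trans (*-distribˡ-ΣS² N z _)
        (ΣS-cong N (λ P → ΣS-cong N (λ T → trans (sym (*-assoc _ _ _)) (*-cong (sym (*-assoc _ _ _)) refl)))))

      ∧-·ʳ : ∀ z (a b : Λ N) → (a ∧ (z · b)) ≈Λ (z · (a ∧ b))
      ∧-·ʳ z a b U = sym (trans (*-distribˡ-ΣS² N z _)
        (ΣS-cong N (λ P → ΣS-cong N (λ T → trans (sym (*-assoc _ _ _)) (*-cong (x∙yz≈y∙xz _ _ _) refl)))))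

      ∧-zeroˡ : (b : Λ N) → (0Λ ∧ b) ≈Λ 0Λ
      ∧-zeroˡ b U = sumL-zero (allSubsets N) (λ P →
        sumL-zero (allSubsets N) (λ T → trans (*-cong (zeroˡ _) refl) (zeroˡ _)))

      ∧-zeroʳ : (b : Λ N) → (b ∧ 0Λ) ≈Λ 0Λ
      ∧-zeroʳ b U = sumL-zero (allSubsets N) (λ P →
        sumL-zero (allSubsets N) (λ T → trans (*-cong (zeroʳ _) refl) (zeroˡ _)))

      basis-∧ : (S T : Subset N) → (basis S ∧ basis T) ≈Λ wc S T
      basis-∧ S T U = begin
        ΣS N (λ P → ΣS N (λ Q → (δ S P * δ T Q) * wc P Q U))  ≈⟨ ΣS-cong N (λ P → ΣS-cong N (λ Q → *-assoc _ _ _)) ⟩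
        ΣS N (λ P → ΣS N (λ Q → δ S P * (δ T Q * wc P Q U)))  ≈⟨ ΣS-cong N (λ P → *-distribˡ-sumL (allSubsets N) _ _) ⟨
        ΣS N (λ P → δ S P * ΣS N (λ Q → δ T Q * wc P Q U))    ≈⟨ ΣS-cong N (λ P → *-cong refl (ΣS-δˡ N T _)) ⟩
        ΣS N (λ P → δ S P * wc P T U)                         ≈⟨ ΣS-δˡ N S _ ⟩
        wc S T U                                              ∎

  open Coefficientwise public
  open ΛReasoning

  module _ {N : ℕ} where
    -Λ-distribˡ-∧ : (a b : Λ N) → ((-Λ a) ∧ b) ≈Λ (-Λ (a ∧ b))
    -Λ-distribˡ-∧ a b = begin
      (-Λ a) ∧ b           ≈⟨ ∧-cong (-Λ≈-1· a) ≈Λ-refl ⟩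
      ((- 1#) · a) ∧ b     ≈⟨ ∧-·ˡ _ a b ⟩
      (- 1#) · (a ∧ b)     ≈⟨ -Λ≈-1· _ ⟨
      -Λ (a ∧ b)           ∎

    -Λ-distribʳ-∧ : (a b : Λ N) → (a ∧ (-Λ b)) ≈Λ (-Λ (a ∧ b))
    -Λ-distribʳ-∧ a b = begin
      a ∧ (-Λ b)           ≈⟨ ∧-cong ≈Λ-refl (-Λ≈-1· b) ⟩
      a ∧ ((- 1#) · b)     ≈⟨ ∧-·ʳ _ a b ⟩
      (- 1#) · (a ∧ b)     ≈⟨ -Λ≈-1· _ ⟨
      -Λ (a ∧ b)           ∎

    ∧-expandˡ : (a b : Λ N) → (a ∧ b) ≈Λ linComb a (λ S → basis S ∧ b)
    ∧-expandˡ a b = begin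
      a ∧ b                ≈⟨ ∧-cong (linComb-basis a) ≈Λ-refl ⟨
      linComb a basis ∧ b  ≈⟨ ∧-linCombˡ a basis b ⟩
      linComb a (λ S → basis S ∧ b) ∎

    ∧-expandʳ : (a b : Λ N) → (a ∧ b) ≈Λ linComb b (λ T → a ∧ basis T)
    ∧-expandʳ a b = begin
      a ∧ b                ≈⟨ ∧-cong ≈Λ-refl (linComb-basis b) ⟨
      a ∧ linComb b basis  ≈⟨ ∧-linCombʳ a b basis ⟩
      linComb b (λ T → a ∧ basis T) ∎

    ∧-identityˡ : (a : Λ N) → (1Λ ∧ a) ≈Λ a
    ∧-identityˡ a = begin
      1Λ ∧ a                          ≈⟨ ∧-expandʳ 1Λ a ⟩
      linComb a (λ T → 1Λ ∧ basis T)  ≈⟨ linComb-cong (λ _ → refl) (λ T → ≈Λ-trans (basis-∧ ∅ T) (wc-∅ˡ T)) ⟩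
      linComb a basis                 ≈⟨ linComb-basis a ⟩
      a                               ∎

    ∧-identityʳ : (a : Λ N) → (a ∧ 1Λ) ≈Λ a
    ∧-identityʳ a = begin
      a ∧ 1Λ                          ≈⟨ ∧-expandˡ a 1Λ ⟩
      linComb a (λ S → basis S ∧ 1Λ)  ≈⟨ linComb-cong (λ _ → refl) (λ S → ≈Λ-trans (basis-∧ S ∅) (wc-∅ʳ S)) ⟩
      linComb a basis                 ≈⟨ linComb-basis a ⟩
      a                               ∎

    ∧-basis-assoc : (S T R : Subset N) → ((basis S ∧ basis T) ∧ basis R) ≈Λ (basis S ∧ (basis T ∧ basis R))
    ∧-basis-assoc S T R = begin
      (basis S ∧ basis T) ∧ basis R                ≈⟨ ∧-cong (basis-∧ S T) ≈Λ-refl ⟩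
      wc S T ∧ basis R                             ≈⟨ ∧-expandˡ (wc S T) (basis R) ⟩
      linComb (wc S T) (λ V → basis V ∧ basis R)   ≈⟨ linComb-cong (λ _ → refl) (λ V → basis-∧ V R) ⟩
      linComb (wc S T) (λ V → wc V R)              ≈⟨ linComb-wc-assoc S T R ⟩
      linComb (wc T R) (wc S)                      ≈⟨ linComb-cong (λ _ → refl) (λ V → basis-∧ S V) ⟨
      linComb (wc T R) (λ V → basis S ∧ basis V)   ≈⟨ ∧-expandʳ (basis S) (wc T R) ⟨
      basis S ∧ wc T R                             ≈⟨ ∧-cong ≈Λ-refl (basis-∧ T R) ⟨
      basis S ∧ (basis T ∧ basis R)                ∎

    ∧-assoc : (a b d : Λ N) → ((a ∧ b) ∧ d) ≈Λ (a ∧ (b ∧ d))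
    ∧-assoc a b d = begin
      (a ∧ b) ∧ d                                                   ≈⟨ ∧-cong (∧-expandˡ a b) ≈Λ-refl ⟩
      linComb a (λ S → basis S ∧ b) ∧ d                             ≈⟨ ∧-linCombˡ a _ d ⟩
      linComb a (λ S → (basis S ∧ b) ∧ d)                           ≈⟨ linComb-cong (λ _ → refl) (λ S → expand S) ⟩
      linComb a (λ S → linComb b (λ T → linComb d (λ R → basis S ∧ (basis T ∧ basis R)))) ≈⟨ linComb-cong (λ _ → refl) (λ S → collapse S) ⟩
      linComb a (λ S → basis S ∧ (b ∧ d))                           ≈⟨ ∧-expandˡ a (b ∧ d) ⟨
      a ∧ (b ∧ d)                                                   ∎
      where
      expand : ∀ S → ((basis S ∧ b) ∧ d) ≈Λ linComb b (λ T → linComb d (λ R → basis S ∧ (basis T ∧ basis R)))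
      expand S = begin
        (basis S ∧ b) ∧ d                            ≈⟨ ∧-cong (∧-expandʳ (basis S) b) ≈Λ-refl ⟩
        linComb b (λ T → basis S ∧ basis T) ∧ d      ≈⟨ ∧-linCombˡ b _ d ⟩
        linComb b (λ T → (basis S ∧ basis T) ∧ d)    ≈⟨ linComb-cong (λ _ → refl) (λ T → ∧-expandʳ _ d) ⟩
        linComb b (λ T → linComb d (λ R → (basis S ∧ basis T) ∧ basis R))
          ≈⟨ linComb-cong (λ _ → refl) (λ T → linComb-cong (λ _ → refl) (λ R → ∧-basis-assoc S T R)) ⟩
        linComb b (λ T → linComb d (λ R → basis S ∧ (basis T ∧ basis R))) ∎
      collapse : ∀ S → linComb b (λ T → linComb d (λ R → basis S ∧ (basis T ∧ basis R))) ≈Λ (basis S ∧ (b ∧ d))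
      collapse S = begin
        linComb b (λ T → linComb d (λ R → basis S ∧ (basis T ∧ basis R)))
          ≈⟨ linComb-cong (λ _ → refl) (λ T → ∧-linCombʳ (basis S) d _) ⟨
        linComb b (λ T → basis S ∧ linComb d (λ R → basis T ∧ basis R))
          ≈⟨ linComb-cong (λ _ → refl) (λ T → ∧-cong ≈Λ-refl (∧-expandʳ (basis T) d)) ⟨
        linComb b (λ T → basis S ∧ (basis T ∧ d))    ≈⟨ ∧-linCombʳ (basis S) b _ ⟨
        basis S ∧ linComb b (λ T → basis T ∧ d)      ≈⟨ ∧-cong ≈Λ-refl (∧-expandˡ b d) ⟨
        basis S ∧ (b ∧ d)                            ∎

  -- Linear v x: v is a degree-one element whose coefficients sum to x, so that ∂ v = x.
  data Linear {L : ℕ} : Λ L → Carrier → Set (c ⊔ ℓ) where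
    single   : ∀ a → Linear (basis ⁅ a ⁆) 1#
    negate   : ∀ {v x} → Linear v x → Linear (-Λ v) (- x)
    plus     : ∀ {v w x y} → Linear v x → Linear w y → Linear (v +Λ w) (x + y)
    respects : ∀ {v w x y} → v ≈Λ w → x ≈ y → Linear v x → Linear w y

  module _ {N : ℕ} where
    basis-⁅⁆-anticomm : (a b : Fin N) → (basis ⁅ a ⁆ ∧ basis ⁅ b ⁆) ≈Λ (-Λ (basis ⁅ b ⁆ ∧ basis ⁅ a ⁆))
    basis-⁅⁆-anticomm a b = begin
      basis ⁅ a ⁆ ∧ basis ⁅ b ⁆         ≈⟨ basis-∧ ⁅ a ⁆ ⁅ b ⁆ ⟩
      wc ⁅ a ⁆ ⁅ b ⁆                    ≈⟨ wc-⁅⁆-anticomm a b ⟩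
      -Λ wc ⁅ b ⁆ ⁅ a ⁆                 ≈⟨ -Λ-cong (basis-∧ ⁅ b ⁆ ⁅ a ⁆) ⟨
      -Λ (basis ⁅ b ⁆ ∧ basis ⁅ a ⁆)    ∎

    ∧-anticommˡ : ∀ {u v : Λ N} {x} → Linear u x →
      (∀ a → (basis ⁅ a ⁆ ∧ v) ≈Λ (-Λ (v ∧ basis ⁅ a ⁆))) → (u ∧ v) ≈Λ (-Λ (v ∧ u))
    ∧-anticommˡ (single a) h = h a
    ∧-anticommˡ {v = v} (negate {u} p) h = begin
      (-Λ u) ∧ v          ≈⟨ -Λ-distribˡ-∧ u v ⟩
      -Λ (u ∧ v)          ≈⟨ -Λ-cong (∧-anticommˡ p h) ⟩
      -Λ (-Λ (v ∧ u))     ≈⟨ -Λ-cong (-Λ-distribʳ-∧ v u) ⟨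
      -Λ (v ∧ (-Λ u))     ∎
    ∧-anticommˡ {v = v} (plus {u} {w} p q) h = begin
      (u +Λ w) ∧ v                       ≈⟨ ∧-distribʳ-+Λ u w v ⟩
      (u ∧ v) +Λ (w ∧ v)                 ≈⟨ +Λ-cong (∧-anticommˡ p h) (∧-anticommˡ q h) ⟩
      (-Λ (v ∧ u)) +Λ (-Λ (v ∧ w))       ≈⟨ -Λ-distrib-+Λ _ _ ⟨
      -Λ ((v ∧ u) +Λ (v ∧ w))            ≈⟨ -Λ-cong (∧-distribˡ-+Λ u w v) ⟨
      -Λ (v ∧ (u +Λ w))                  ∎
    ∧-anticommˡ (respects eq _ p) h =
      ≈Λ-trans (∧-cong (≈Λ-sym eq) ≈Λ-refl) (≈Λ-trans (∧-anticommˡ p h) (-Λ-cong (∧-cong ≈Λ-refl eq)))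

    ∧-anticomm : ∀ {u v : Λ N} {x y} → Linear u x → Linear v y → (u ∧ v) ≈Λ (-Λ (v ∧ u))
    ∧-anticomm p q = ∧-anticommˡ p (λ a → -Λ-swap (∧-anticommˡ q (λ b → basis-⁅⁆-anticomm b a)))
      where
      -Λ-swap : ∀ {a b : Λ N} → a ≈Λ (-Λ b) → b ≈Λ (-Λ a)
      -Λ-swap {a} {b} e = ≈Λ-trans (≈Λ-sym (-Λ-involutive b)) (-Λ-cong (≈Λ-sym e))

    ∧-self-zero : ∀ {v : Λ N} {x} → Linear v x → (v ∧ v) ≈Λ 0Λ
    ∧-self-zero (single a) = ≈Λ-trans (basis-∧ ⁅ a ⁆ ⁅ a ⁆) (wc-⁅⁆-square a)
    ∧-self-zero (negate {v} p) = begin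
      (-Λ v) ∧ (-Λ v)        ≈⟨ -Λ-distribˡ-∧ v (-Λ v) ⟩
      -Λ (v ∧ (-Λ v))        ≈⟨ -Λ-cong (-Λ-distribʳ-∧ v v) ⟩
      -Λ (-Λ (v ∧ v))        ≈⟨ -Λ-involutive _ ⟩
      v ∧ v                  ≈⟨ ∧-self-zero p ⟩
      0Λ                     ∎
    ∧-self-zero (plus {v} {w} p q) = begin
      (v +Λ w) ∧ (v +Λ w)                                    ≈⟨ ∧-distribʳ-+Λ v w _ ⟩
      (v ∧ (v +Λ w)) +Λ (w ∧ (v +Λ w))                       ≈⟨ +Λ-cong (∧-distribˡ-+Λ v w v) (∧-distribˡ-+Λ v w w) ⟩
      ((v ∧ v) +Λ (v ∧ w)) +Λ ((w ∧ v) +Λ (w ∧ w))           ≈⟨ +Λ-cong (+Λ-cong (∧-self-zero p) ≈Λ-refl)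
                                                                         (+Λ-cong (∧-anticomm q p) (∧-self-zero q)) ⟩
      (0Λ +Λ (v ∧ w)) +Λ ((-Λ (v ∧ w)) +Λ 0Λ)                ≈⟨ +Λ-cong (+Λ-identityˡ _) (+Λ-identityʳ _) ⟩
      (v ∧ w) +Λ (-Λ (v ∧ w))                                ≈⟨ +Λ-inverseʳ _ ⟩
      0Λ                                                     ∎
    ∧-self-zero (respects eq _ p) = ≈Λ-trans (∧-cong (≈Λ-sym eq) (≈Λ-sym eq)) (∧-self-zero p)

  AllLinear : ∀ {N L} → (Fin N → Λ L) → Set (c ⊔ ℓ)
  AllLinear g = ∀ i → Σ Carrier (Linear (g i))

  mono-cong : ∀ {N L} {g h : Fin N → Λ L} → (∀ i → g i ≈Λ h i) → ∀ S → mono g S ≈Λ mono h S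
  mono-cong p []            = ≈Λ-refl
  mono-cong p (inside ∷ S)  = ∧-cong (p zero) (mono-cong (p ∘ suc) S)
  mono-cong p (outside ∷ S) = mono-cong (p ∘ suc) S

  mono-∧-comm : ∀ {N L} (h : Fin N → Λ L) → AllLinear h → ∀ {v x} → Linear v x → ∀ S →
    (mono h S ∧ v) ≈Λ (sign S · (v ∧ mono h S))
  mono-∧-comm h H {v} p []            = ≈Λ-trans (∧-identityˡ v) (≈Λ-sym (≈Λ-trans (·-identityˡ _) (∧-identityʳ v)))
  mono-∧-comm h H {v} p (inside ∷ S)  = begin
    (h₀ ∧ A) ∧ v                    ≈⟨ ∧-assoc h₀ A v ⟩
    h₀ ∧ (A ∧ v)                    ≈⟨ ∧-cong ≈Λ-refl (mono-∧-comm (h ∘ suc) (H ∘ suc) p S) ⟩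
    h₀ ∧ (sign S · (v ∧ A))         ≈⟨ ∧-·ʳ _ h₀ _ ⟩
    sign S · (h₀ ∧ (v ∧ A))         ≈⟨ ·-cong refl (∧-assoc h₀ v A) ⟨
    sign S · ((h₀ ∧ v) ∧ A)         ≈⟨ ·-cong refl (∧-cong (∧-anticomm (proj₂ (H zero)) p) ≈Λ-refl) ⟩
    sign S · ((-Λ (v ∧ h₀)) ∧ A)    ≈⟨ ·-cong refl (-Λ-distribˡ-∧ _ A) ⟩
    sign S · (-Λ ((v ∧ h₀) ∧ A))    ≈⟨ ·-neg _ _ ⟩
    (- sign S) · ((v ∧ h₀) ∧ A)     ≈⟨ ·-cong refl (∧-assoc v h₀ A) ⟩
    (- sign S) · (v ∧ (h₀ ∧ A))     ∎
    where
    h₀ = h zero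
    A  = mono (h ∘ suc) S
  mono-∧-comm h H p (outside ∷ S) = mono-∧-comm (h ∘ suc) (H ∘ suc) p S

  ∧-mono-comm : ∀ {N L} (h : Fin N → Λ L) → AllLinear h → ∀ {v x} → Linear v x → ∀ S →
    (v ∧ mono h S) ≈Λ (sign S · (mono h S ∧ v))
  ∧-mono-comm h H {v} p S = ≈Λ-sym (begin
    sign S · (mono h S ∧ v)                 ≈⟨ ·-cong refl (mono-∧-comm h H p S) ⟩
    sign S · (sign S · (v ∧ mono h S))      ≈⟨ ·-assoc _ _ _ ⟩
    (sign S * sign S) · (v ∧ mono h S)      ≈⟨ ·-cong (negPow-square ∣ S ∣) ≈Λ-refl ⟩
    1# · (v ∧ mono h S)                     ≈⟨ ·-identityˡ _ ⟩
    v ∧ mono h S                            ∎)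

  mono-wc : ∀ {N L} (g : Fin N → Λ L) → AllLinear g → ∀ S T →
    linComb (wc S T) (mono g) ≈Λ (mono g S ∧ mono g T)
  mono-wc g G []            []            =
    ≈Λ-trans (linComb-empty _ _) (≈Λ-trans (·-identityˡ _) (≈Λ-sym (∧-identityˡ _)))
  mono-wc g G (inside ∷ S)  (inside ∷ T)  = ≈Λ-trans (linComb-zero _ _ (λ _ → refl)) (≈Λ-sym (begin
    (g₀ ∧ A) ∧ (g₀ ∧ B)                ≈⟨ ∧-assoc _ g₀ B ⟨
    ((g₀ ∧ A) ∧ g₀) ∧ B                ≈⟨ ∧-cong (∧-assoc g₀ A g₀) ≈Λ-refl ⟩
    (g₀ ∧ (A ∧ g₀)) ∧ B                ≈⟨ ∧-cong (∧-cong ≈Λ-refl (mono-∧-comm (g ∘ suc) (G ∘ suc) (proj₂ (G zero)) S)) ≈Λ-refl ⟩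
    (g₀ ∧ (sign S · (g₀ ∧ A))) ∧ B     ≈⟨ ∧-cong (∧-·ʳ _ g₀ _) ≈Λ-refl ⟩
    (sign S · (g₀ ∧ (g₀ ∧ A))) ∧ B     ≈⟨ ∧-·ˡ _ _ B ⟩
    sign S · ((g₀ ∧ (g₀ ∧ A)) ∧ B)     ≈⟨ ·-cong refl (∧-cong (∧-assoc g₀ g₀ A) ≈Λ-refl) ⟨
    sign S · (((g₀ ∧ g₀) ∧ A) ∧ B)     ≈⟨ ·-cong refl (∧-cong (∧-cong (∧-self-zero (proj₂ (G zero))) ≈Λ-refl) ≈Λ-refl) ⟩
    sign S · ((0Λ ∧ A) ∧ B)            ≈⟨ ·-cong refl (≈Λ-trans (∧-cong (∧-zeroˡ A) ≈Λ-refl) (∧-zeroˡ B)) ⟩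
    sign S · 0Λ                        ≈⟨ ·-zeroʳ _ ⟩
    0Λ                                 ∎))
    where
    g₀ = g zero
    A  = mono (g ∘ suc) S
    B  = mono (g ∘ suc) T
  mono-wc g G (inside ∷ S)  (outside ∷ T) = begin
    linComb (wc (inside ∷ S) (outside ∷ T)) (mono g)            ≈⟨ linComb-split _ _ ⟩
    linComb (wc S T) (λ U → g₀ ∧ mono (g ∘ suc) U) +Λ _         ≈⟨ +Λ-cong ≈Λ-refl (linComb-zero _ _ (λ _ → refl)) ⟩
    linComb (wc S T) (λ U → g₀ ∧ mono (g ∘ suc) U) +Λ 0Λ        ≈⟨ +Λ-identityʳ _ ⟩
    linComb (wc S T) (λ U → g₀ ∧ mono (g ∘ suc) U)              ≈⟨ ∧-linCombʳ g₀ _ _ ⟨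
    g₀ ∧ linComb (wc S T) (mono (g ∘ suc))                      ≈⟨ ∧-cong ≈Λ-refl (mono-wc (g ∘ suc) (G ∘ suc) S T) ⟩
    g₀ ∧ (A ∧ B)                                                ≈⟨ ∧-assoc g₀ A B ⟨
    (g₀ ∧ A) ∧ B                                                ∎
    where
    g₀ = g zero
    A  = mono (g ∘ suc) S
    B  = mono (g ∘ suc) T
  mono-wc g G (outside ∷ S) (inside ∷ T)  = begin
    linComb (wc (outside ∷ S) (inside ∷ T)) (mono g)                  ≈⟨ linComb-split _ _ ⟩
    linComb (λ U → sign S * wc S T U) (λ U → g₀ ∧ mono (g ∘ suc) U) +Λ _ ≈⟨ +Λ-cong ≈Λ-refl (linComb-zero _ _ (λ _ → refl)) ⟩
    linComb (λ U → sign S * wc S T U) (λ U → g₀ ∧ mono (g ∘ suc) U) +Λ 0Λ ≈⟨ +Λ-identityʳ _ ⟩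
    linComb (λ U → sign S * wc S T U) (λ U → g₀ ∧ mono (g ∘ suc) U)   ≈⟨ linComb-· _ _ _ ⟩
    sign S · linComb (wc S T) (λ U → g₀ ∧ mono (g ∘ suc) U)           ≈⟨ ·-cong refl (∧-linCombʳ g₀ _ _) ⟨
    sign S · (g₀ ∧ linComb (wc S T) (mono (g ∘ suc)))                 ≈⟨ ·-cong refl (∧-cong ≈Λ-refl (mono-wc (g ∘ suc) (G ∘ suc) S T)) ⟩
    sign S · (g₀ ∧ (A ∧ B))                                           ≈⟨ ·-cong refl (∧-assoc g₀ A B) ⟨
    sign S · ((g₀ ∧ A) ∧ B)                                           ≈⟨ ∧-·ˡ _ _ B ⟨
    (sign S · (g₀ ∧ A)) ∧ B                                           ≈⟨ ∧-cong (mono-∧-comm (g ∘ suc) (G ∘ suc) (proj₂ (G zero)) S) ≈Λ-refl ⟨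
    (A ∧ g₀) ∧ B                                                      ≈⟨ ∧-assoc A g₀ B ⟩
    A ∧ (g₀ ∧ B)                                                      ∎
    where
    g₀ = g zero
    A  = mono (g ∘ suc) S
    B  = mono (g ∘ suc) T
  mono-wc g G (outside ∷ S) (outside ∷ T) = begin
    linComb (wc (outside ∷ S) (outside ∷ T)) (mono g)        ≈⟨ linComb-split _ _ ⟩
    _ +Λ linComb (wc S T) (mono (g ∘ suc))                   ≈⟨ +Λ-cong (linComb-zero _ _ (λ _ → refl)) ≈Λ-refl ⟩
    0Λ +Λ linComb (wc S T) (mono (g ∘ suc))                  ≈⟨ +Λ-identityˡ _ ⟩
    linComb (wc S T) (mono (g ∘ suc))                        ≈⟨ mono-wc (g ∘ suc) (G ∘ suc) S T ⟩
    mono (g ∘ suc) S ∧ mono (g ∘ suc) T                      ∎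

  module _ {N L : ℕ} (g : Fin N → Λ L) where
    extHom-cong : {f f' : Λ N} → f ≈Λ f' → extHom g f ≈Λ extHom g f'
    extHom-cong {f} {f'} p = begin
      extHom g f              ≈⟨ extHom≈linComb g f ⟩
      linComb f (mono g)      ≈⟨ linComb-cong p (λ _ → ≈Λ-refl) ⟩
      linComb f' (mono g)     ≈⟨ extHom≈linComb g f' ⟨
      extHom g f'             ∎

    extHom-0Λ : extHom g 0Λ ≈Λ 0Λ
    extHom-0Λ = ≈Λ-trans (extHom≈linComb g 0Λ) (linComb-zero _ _ (λ _ → refl))

    extHom-+Λ : (f f' : Λ N) → extHom g (f +Λ f') ≈Λ (extHom g f +Λ extHom g f')
    extHom-+Λ f f' = begin
      extHom g (f +Λ f')                       ≈⟨ extHom≈linComb g _ ⟩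
      linComb (f +Λ f') (mono g)               ≈⟨ linComb-+ˡ f f' _ ⟩
      linComb f (mono g) +Λ linComb f' (mono g) ≈⟨ +Λ-cong (extHom≈linComb g f) (extHom≈linComb g f') ⟨
      extHom g f +Λ extHom g f'                ∎

    extHom-∧ : AllLinear g → (a b : Λ N) → extHom g (a ∧ b) ≈Λ (extHom g a ∧ extHom g b)
    extHom-∧ G a b = begin
      extHom g (a ∧ b)                                                     ≈⟨ extHom≈linComb g _ ⟩
      linComb (a ∧ b) (mono g)                                             ≈⟨ linComb-cong (expand-∧ a b) (λ _ → ≈Λ-refl) ⟩
      linComb (linComb a (λ S → linComb b (wc S))) (mono g)                ≈⟨ linComb-assoc a _ (mono g) ⟩
      linComb a (λ S → linComb (linComb b (wc S)) (mono g))                ≈⟨ linComb-cong (λ _ → refl) (λ S → linComb-assoc b _ (mono g)) ⟩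
      linComb a (λ S → linComb b (λ T → linComb (wc S T) (mono g)))
        ≈⟨ linComb-cong (λ _ → refl) (λ S → linComb-cong (λ _ → refl) (λ T → mono-wc g G S T)) ⟩
      linComb a (λ S → linComb b (λ T → mono g S ∧ mono g T))              ≈⟨ linComb-cong (λ _ → refl) (λ S → ∧-linCombʳ (mono g S) b (mono g)) ⟨
      linComb a (λ S → mono g S ∧ linComb b (mono g))                      ≈⟨ ∧-linCombˡ a (mono g) _ ⟨
      linComb a (mono g) ∧ linComb b (mono g)                              ≈⟨ ∧-cong (extHom≈linComb g a) (extHom≈linComb g b) ⟨
      extHom g a ∧ extHom g b                                              ∎
      where
      expand-∧ : (a b : Λ N) → (a ∧ b) ≈Λ linComb a (λ S → linComb b (wc S))
      expand-∧ a b = begin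
        a ∧ b                                          ≈⟨ ∧-expandˡ a b ⟩
        linComb a (λ S → basis S ∧ b)                  ≈⟨ linComb-cong (λ _ → refl) (λ S → ∧-expandʳ (basis S) b) ⟩
        linComb a (λ S → linComb b (λ T → basis S ∧ basis T)) ≈⟨ linComb-cong (λ _ → refl) (λ S → linComb-cong (λ _ → refl) (basis-∧ S)) ⟩
        linComb a (λ S → linComb b (wc S))             ∎

  ∂Λ : ∀ {N} → Λ N → Λ N
  ∂Λ f = linComb f ∂e

  module _ {N : ℕ} where
    ∂-cong : {f f' : Λ N} → f ≈Λ f' → ∂Λ f ≈Λ ∂Λ f'
    ∂-cong p = linComb-cong p (λ _ → ≈Λ-refl)

    ∂-basis : (S : Subset N) → ∂Λ (basis S) ≈Λ ∂e S
    ∂-basis S = linComb-δ S ∂e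

    ∂-1Λ : ∂Λ (1Λ {N}) ≈Λ 0Λ
    ∂-1Λ = ≈Λ-trans (∂-basis ∅) (∂e-∅ {N})
      where
      ∂e-∅ : ∀ {N} (U : Subset N) → ∂e ∅ U ≈ 0#
      ∂e-∅ []            = refl
      ∂e-∅ (inside ∷ U)  = refl
      ∂e-∅ (outside ∷ U) = ∂e-∅ U

    ∂-+Λ : (f f' : Λ N) → ∂Λ (f +Λ f') ≈Λ (∂Λ f +Λ ∂Λ f')
    ∂-+Λ f f' = linComb-+ˡ f f' ∂e

    ∂-neg : (f : Λ N) → ∂Λ (-Λ f) ≈Λ (-Λ ∂Λ f)
    ∂-neg f = linComb-negˡ f ∂e

    ∂-· : ∀ z (f : Λ N) → ∂Λ (z · f) ≈Λ (z · ∂Λ f)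
    ∂-· z f = linComb-· z f ∂e

  opaque
    unfolding linComb
    ∂-wc-⁅⁆ : ∀ {N} (a : Fin N) (T : Subset N) →
      linComb (wc ⁅ a ⁆ T) ∂e ≈Λ (basis T +Λ (-Λ linComb (∂e T) (wc ⁅ a ⁆)))
    ∂-wc-⁅⁆ {N} a T U = ∂e-wc-⁅⁆ N a T U

  module _ {N : ℕ} where
    basis-⁅⁆-∧ : (a : Fin N) (f : Λ N) → (basis ⁅ a ⁆ ∧ f) ≈Λ linComb f (wc ⁅ a ⁆)
    basis-⁅⁆-∧ a f = ≈Λ-trans (∧-expandʳ _ f) (linComb-cong (λ _ → refl) (basis-∧ ⁅ a ⁆))

    ∂-basis-⁅⁆-∧ : (a : Fin N) (b : Λ N) → ∂Λ (basis ⁅ a ⁆ ∧ b) ≈Λ (b +Λ (-Λ (basis ⁅ a ⁆ ∧ ∂Λ b)))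
    ∂-basis-⁅⁆-∧ a b = begin
      ∂Λ (basis ⁅ a ⁆ ∧ b)                                              ≈⟨ ∂-cong (basis-⁅⁆-∧ a b) ⟩
      ∂Λ (linComb b (wc ⁅ a ⁆))                                         ≈⟨ linComb-assoc b _ ∂e ⟩
      linComb b (λ T → linComb (wc ⁅ a ⁆ T) ∂e)                         ≈⟨ linComb-cong (λ _ → refl) (∂-wc-⁅⁆ a) ⟩
      linComb b (λ T → basis T +Λ (-Λ linComb (∂e T) (wc ⁅ a ⁆)))       ≈⟨ linComb-+ʳ b _ _ ⟩
      linComb b basis +Λ linComb b (λ T → -Λ linComb (∂e T) (wc ⁅ a ⁆)) ≈⟨ +Λ-cong (linComb-basis b) (linComb-negʳ b _) ⟩
      b +Λ (-Λ linComb b (λ T → linComb (∂e T) (wc ⁅ a ⁆)))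
        ≈⟨ +Λ-cong ≈Λ-refl (-Λ-cong (linComb-cong (λ _ → refl) (λ T → basis-⁅⁆-∧ a (∂e T)))) ⟨
      b +Λ (-Λ linComb b (λ T → basis ⁅ a ⁆ ∧ ∂e T))                    ≈⟨ +Λ-cong ≈Λ-refl (-Λ-cong (∧-linCombʳ _ b ∂e)) ⟨
      b +Λ (-Λ (basis ⁅ a ⁆ ∧ ∂Λ b))                                    ∎

    ∂-∧ : ∀ {v : Λ N} {x} → Linear v x → ∀ b → ∂Λ (v ∧ b) ≈Λ ((x · b) +Λ (-Λ (v ∧ ∂Λ b)))
    ∂-∧ (single a) b = ≈Λ-trans (∂-basis-⁅⁆-∧ a b) (+Λ-cong (≈Λ-sym (·-identityˡ b)) ≈Λ-refl)
    ∂-∧ (negate {v} {x} p) b = begin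
      ∂Λ ((-Λ v) ∧ b)                                ≈⟨ ∂-cong (-Λ-distribˡ-∧ v b) ⟩
      ∂Λ (-Λ (v ∧ b))                                ≈⟨ ∂-neg _ ⟩
      -Λ ∂Λ (v ∧ b)                                  ≈⟨ -Λ-cong (∂-∧ p b) ⟩
      -Λ ((x · b) +Λ (-Λ (v ∧ ∂Λ b)))                ≈⟨ -Λ-distrib-+Λ _ _ ⟩
      (-Λ (x · b)) +Λ (-Λ (-Λ (v ∧ ∂Λ b)))           ≈⟨ +Λ-cong (-Λ-· x b) (-Λ-cong (≈Λ-sym (-Λ-distribˡ-∧ v _))) ⟩
      ((- x) · b) +Λ (-Λ ((-Λ v) ∧ ∂Λ b))            ∎
    ∂-∧ (plus {v} {w} {x} {y} p q) b = begin
      ∂Λ ((v +Λ w) ∧ b)                                                   ≈⟨ ∂-cong (∧-distribʳ-+Λ v w b) ⟩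
      ∂Λ ((v ∧ b) +Λ (w ∧ b))                                             ≈⟨ ∂-+Λ _ _ ⟩
      ∂Λ (v ∧ b) +Λ ∂Λ (w ∧ b)                                            ≈⟨ +Λ-cong (∂-∧ p b) (∂-∧ q b) ⟩
      ((x · b) +Λ (-Λ (v ∧ ∂Λ b))) +Λ ((y · b) +Λ (-Λ (w ∧ ∂Λ b)))        ≈⟨ +Λ-interchange _ _ _ _ ⟩
      ((x · b) +Λ (y · b)) +Λ ((-Λ (v ∧ ∂Λ b)) +Λ (-Λ (w ∧ ∂Λ b)))        ≈⟨ +Λ-cong (·-distribʳ x y b) (-Λ-distrib-+Λ _ _) ⟨
      ((x + y) · b) +Λ (-Λ ((v ∧ ∂Λ b) +Λ (w ∧ ∂Λ b)))                    ≈⟨ +Λ-cong ≈Λ-refl (-Λ-cong (∧-distribʳ-+Λ v w _)) ⟨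
      ((x + y) · b) +Λ (-Λ ((v +Λ w) ∧ ∂Λ b))                             ∎
    ∂-∧ (respects eq eqx p) b = ≈Λ-trans (∂-cong (∧-cong (≈Λ-sym eq) ≈Λ-refl))
      (≈Λ-trans (∂-∧ p b) (+Λ-cong (·-cong eqx ≈Λ-refl) (-Λ-cong (∧-cong eq ≈Λ-refl))))

  ∂-mono : ∀ {N L} (g : Fin N → Λ L) → (∀ i → Linear (g i) 1#) → ∀ S → ∂Λ (mono g S) ≈Λ extHom g (∂e S)
  ∂-mono g G []            = ≈Λ-trans ∂-1Λ (≈Λ-sym (≈Λ-trans (extHom≈linComb g _) (linComb-zero (∂e {0} []) (mono g) (λ { [] → refl }))))
  ∂-mono g G (inside ∷ S)  = begin
    ∂Λ (g₀ ∧ A)                                                         ≈⟨ ∂-∧ (G zero) A ⟩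
    (1# · A) +Λ (-Λ (g₀ ∧ ∂Λ A))                                        ≈⟨ +Λ-comm _ _ ⟩
    (-Λ (g₀ ∧ ∂Λ A)) +Λ (1# · A)                                        ≈⟨ +Λ-cong (-Λ-cong (∧-cong ≈Λ-refl ∂A)) (·-identityˡ A) ⟩
    (-Λ (g₀ ∧ linComb (∂e S) (mono (g ∘ suc)))) +Λ A                    ≈⟨ +Λ-cong (-Λ-cong (∧-linCombʳ g₀ _ _)) (≈Λ-sym (linComb-δ S _)) ⟩
    (-Λ linComb (∂e S) (λ W → g₀ ∧ mono (g ∘ suc) W)) +Λ linComb (basis S) (mono (g ∘ suc))
                                                                        ≈⟨ +Λ-cong (linComb-negˡ _ _) ≈Λ-refl ⟨
    linComb (-Λ ∂e S) (λ W → g₀ ∧ mono (g ∘ suc) W) +Λ linComb (basis S) (mono (g ∘ suc))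
                                                                        ≈⟨ linComb-split _ _ ⟨
    linComb (∂e (inside ∷ S)) (mono g)                                  ≈⟨ extHom≈linComb g _ ⟨
    extHom g (∂e (inside ∷ S))                                          ∎
    where
    g₀ = g zero
    A  = mono (g ∘ suc) S
    ∂A : ∂Λ A ≈Λ linComb (∂e S) (mono (g ∘ suc))
    ∂A = ≈Λ-trans (∂-mono (g ∘ suc) (G ∘ suc) S) (extHom≈linComb _ _)
  ∂-mono g G (outside ∷ S) = begin
    ∂Λ (mono (g ∘ suc) S)                                               ≈⟨ ∂-mono (g ∘ suc) (G ∘ suc) S ⟩
    extHom (g ∘ suc) (∂e S)                                             ≈⟨ extHom≈linComb _ _ ⟩
    linComb (∂e S) (mono (g ∘ suc))                                     ≈⟨ +Λ-identityˡ _ ⟨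
    0Λ +Λ linComb (∂e S) (mono (g ∘ suc))                               ≈⟨ +Λ-cong (linComb-zero _ _ (λ _ → refl)) ≈Λ-refl ⟨
    linComb (λ W → ∂e (outside ∷ S) (inside ∷ W)) (λ W → mono g (inside ∷ W)) +Λ linComb (∂e S) (mono (g ∘ suc))
                                                                        ≈⟨ linComb-split _ _ ⟨
    linComb (∂e (outside ∷ S)) (mono g)                                 ≈⟨ extHom≈linComb g _ ⟨
    extHom g (∂e (outside ∷ S))                                         ∎

  ∂-mono-zero : ∀ {N L} (y : Fin N → Λ L) → (∀ i → Linear (y i) 0#) → ∀ S → ∂Λ (mono y S) ≈Λ 0Λ
  ∂-mono-zero y Y []            = ∂-1Λ
  ∂-mono-zero y Y (inside ∷ S)  = begin
    ∂Λ (y zero ∧ A)                            ≈⟨ ∂-∧ (Y zero) A ⟩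
    (0# · A) +Λ (-Λ (y zero ∧ ∂Λ A))           ≈⟨ +Λ-cong (·-zeroˡ A) (-Λ-cong (∧-cong ≈Λ-refl (∂-mono-zero (y ∘ suc) (Y ∘ suc) S))) ⟩
    0Λ +Λ (-Λ (y zero ∧ 0Λ))                   ≈⟨ +Λ-identityˡ _ ⟩
    -Λ (y zero ∧ 0Λ)                           ≈⟨ -Λ-cong (∧-zeroʳ _) ⟩
    -Λ 0Λ                                      ≈⟨ -Λ-zero ⟩
    0Λ                                         ∎
    where A = mono (y ∘ suc) S
  ∂-mono-zero y Y (outside ∷ S) = ∂-mono-zero (y ∘ suc) (Y ∘ suc) S

  mono-∅ : ∀ {N L} (g : Fin N → Λ L) → mono g ∅ ≈Λ 1Λ
  mono-∅ {zero}  g = ≈Λ-refl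
  mono-∅ {suc N} g = mono-∅ (g ∘ suc)

  mono-⁅⁆ : ∀ {N L} (g : Fin N → Λ L) (i : Fin N) → mono g ⁅ i ⁆ ≈Λ g i
  mono-⁅⁆ g zero    = ≈Λ-trans (∧-cong ≈Λ-refl (mono-∅ (g ∘ suc))) (∧-identityʳ _)
  mono-⁅⁆ g (suc i) = mono-⁅⁆ (g ∘ suc) i

  mono-++ : ∀ {n k L} (g : Fin (n +ℕ k) → Λ L) (A : Subset n) (B : Subset k) →
    mono g (A ++ B) ≈Λ (mono (λ i → g (i ↑ˡ k)) A ∧ mono (λ j → g (n ↑ʳ j)) B)
  mono-++ g []            B = ≈Λ-sym (∧-identityˡ _)
  mono-++ g (inside ∷ A)  B = ≈Λ-trans (∧-cong ≈Λ-refl (mono-++ (g ∘ suc) A B)) (≈Λ-sym (∧-assoc _ _ _))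
  mono-++ g (outside ∷ A) B = mono-++ (g ∘ suc) A B

  mono-full-snoc : ∀ {L} m (h : Fin (suc m) → Λ L) → mono h full ≈Λ (mono (h ∘ inject₁) full ∧ h (fromℕ m))
  mono-full-snoc zero    h = ≈Λ-trans (∧-identityʳ _) (≈Λ-sym (∧-identityˡ _))
  mono-full-snoc (suc m) h = ≈Λ-trans (∧-cong ≈Λ-refl (mono-full-snoc m (h ∘ suc))) (≈Λ-sym (∧-assoc _ _ _))

  shift : ∀ {L} → Λ L → Λ (suc L)
  shift f (inside ∷ U)  = 0#
  shift f (outside ∷ U) = f U

  shift-cong : ∀ {L} {a b : Λ L} → a ≈Λ b → shift a ≈Λ shift b
  shift-cong p (inside ∷ U)  = refl
  shift-cong p (outside ∷ U) = p U

  shift-∧ : ∀ {L} (a b : Λ L) → (shift a ∧ shift b) ≈Λ shift (a ∧ b)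
  shift-∧ {L} a b (inside ∷ U)  = ΣS-suc-zero L _
    (λ P → sumL-zero (allSubsets (suc L)) (λ T → trans (*-cong (zeroˡ _) refl) (zeroˡ _)))
    (λ P → ΣS-suc-zero L _ (λ T → trans (*-cong (zeroʳ _) refl) (zeroˡ _)) (λ T → zeroʳ _))
  shift-∧ {L} a b (outside ∷ U) = trans
    (ΣS-outside L _ (λ P → sumL-zero (allSubsets (suc L)) (λ T → trans (*-cong (zeroˡ _) refl) (zeroˡ _))))
    (ΣS-cong L (λ P → ΣS-outside L _ (λ T → trans (*-cong (zeroʳ _) refl) (zeroˡ _))))

  shift-basis : ∀ {L} (S : Subset L) → shift (basis S) ≈Λ basis (outside ∷ S)
  shift-basis S (inside ∷ U)  = refl
  shift-basis S (outside ∷ U) = refl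

  mono-shift : ∀ {N L} (h : Fin N → Λ L) S → mono (shift ∘ h) S ≈Λ shift (mono h S)
  mono-shift h []            = ≈Λ-sym (shift-basis ∅)
  mono-shift h (inside ∷ S)  = ≈Λ-trans (∧-cong ≈Λ-refl (mono-shift (h ∘ suc) S)) (shift-∧ _ _)
  mono-shift h (outside ∷ S) = mono-shift (h ∘ suc) S

  mono-basis     : ∀ {N} (S : Subset N) → mono (basis ∘ ⁅_⁆) S ≈Λ basis S
  mono-basis-suc : ∀ {N} (S : Subset N) → mono (basis ∘ ⁅_⁆ ∘ suc) S ≈Λ basis (outside ∷ S)

  mono-basis []            = ≈Λ-refl
  mono-basis (inside ∷ S)  = begin
    basis ⁅ zero ⁆ ∧ mono (basis ∘ ⁅_⁆ ∘ suc) S       ≈⟨ ∧-cong ≈Λ-refl (mono-basis-suc S) ⟩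
    basis ⁅ zero ⁆ ∧ basis (outside ∷ S)             ≈⟨ basis-∧ ⁅ zero ⁆ (outside ∷ S) ⟩
    wc ⁅ zero ⁆ (outside ∷ S)                        ≈⟨ (λ { (inside ∷ U) → wc-∅ˡ S U ; (outside ∷ U) → refl }) ⟩
    basis (inside ∷ S)                               ∎
  mono-basis (outside ∷ S) = mono-basis-suc S

  mono-basis-suc S = begin
    mono (basis ∘ ⁅_⁆ ∘ suc) S          ≈⟨ mono-cong (λ i → ≈Λ-sym (shift-basis ⁅ i ⁆)) S ⟩
    mono (shift ∘ basis ∘ ⁅_⁆) S        ≈⟨ mono-shift _ S ⟩
    shift (mono (basis ∘ ⁅_⁆) S)        ≈⟨ shift-cong (mono-basis S) ⟩
    shift (basis S)                     ≈⟨ shift-basis S ⟩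
    basis (outside ∷ S)                 ∎

  -- every summand containing z twice vanishes
  mono-translate-∧ : ∀ {N L} (y : Fin N → Λ L) → AllLinear y → ∀ {z x} → Linear z x → ∀ S →
    (mono (λ i → y i +Λ z) S ∧ z) ≈Λ (mono y S ∧ z)
  mono-translate-∧ y Y p []            = ≈Λ-refl
  mono-translate-∧ y Y {z} p (inside ∷ S) = begin
    ((y₀ +Λ z) ∧ A) ∧ z                  ≈⟨ ∧-assoc _ _ _ ⟩
    (y₀ +Λ z) ∧ (A ∧ z)                  ≈⟨ ∧-cong ≈Λ-refl (mono-translate-∧ (y ∘ suc) (Y ∘ suc) p S) ⟩
    (y₀ +Λ z) ∧ (A' ∧ z)                 ≈⟨ ∧-distribʳ-+Λ _ _ _ ⟩
    (y₀ ∧ (A' ∧ z)) +Λ (z ∧ (A' ∧ z))    ≈⟨ +Λ-cong ≈Λ-refl z∧A'∧z≈0 ⟩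
    (y₀ ∧ (A' ∧ z)) +Λ 0Λ                ≈⟨ +Λ-identityʳ _ ⟩
    y₀ ∧ (A' ∧ z)                        ≈⟨ ∧-assoc _ _ _ ⟨
    (y₀ ∧ A') ∧ z                        ∎
    where
    y₀ = y zero
    A  = mono (λ i → y (suc i) +Λ z) S
    A' = mono (y ∘ suc) S
    z∧A'∧z≈0 : (z ∧ (A' ∧ z)) ≈Λ 0Λ
    z∧A'∧z≈0 = begin
      z ∧ (A' ∧ z)                 ≈⟨ ∧-cong ≈Λ-refl (mono-∧-comm (y ∘ suc) (Y ∘ suc) p S) ⟩
      z ∧ (sign S · (z ∧ A'))      ≈⟨ ∧-·ʳ _ _ _ ⟩
      sign S · (z ∧ (z ∧ A'))      ≈⟨ ·-cong refl (∧-assoc _ _ _) ⟨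
      sign S · ((z ∧ z) ∧ A')      ≈⟨ ·-cong refl (≈Λ-trans (∧-cong (∧-self-zero p) ≈Λ-refl) (∧-zeroˡ _)) ⟩
      sign S · 0Λ                  ≈⟨ ·-zeroʳ _ ⟩
      0Λ                           ∎
  mono-translate-∧ y Y p (outside ∷ S) = mono-translate-∧ (y ∘ suc) (Y ∘ suc) p S

  ∂-mono-∧ : ∀ {N L} (y : Fin N → Λ L) → (∀ i → Linear (y i) 0#) → ∀ {v} → Linear v 1# → ∀ S →
    ∂Λ (mono y S ∧ v) ≈Λ (sign S · mono y S)
  ∂-mono-∧ y Y {v} V S = begin
    ∂Λ (mono y S ∧ v)                                   ≈⟨ ∂-cong (mono-∧-comm y (λ i → 0# , Y i) V S) ⟩
    ∂Λ (sign S · (v ∧ mono y S))                        ≈⟨ ∂-· _ _ ⟩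
    sign S · ∂Λ (v ∧ mono y S)                          ≈⟨ ·-cong refl (∂-∧ V _) ⟩
    sign S · ((1# · mono y S) +Λ (-Λ (v ∧ ∂Λ (mono y S)))) ≈⟨ ·-cong refl (+Λ-cong (·-identityˡ _) (-Λ-cong v∧∂≈0)) ⟩
    sign S · (mono y S +Λ (-Λ 0Λ))                      ≈⟨ ·-cong refl (≈Λ-trans (+Λ-cong ≈Λ-refl -Λ-zero) (+Λ-identityʳ _)) ⟩
    sign S · mono y S                                   ∎
    where
    v∧∂≈0 : (v ∧ ∂Λ (mono y S)) ≈Λ 0Λ
    v∧∂≈0 = ≈Λ-trans (∧-cong ≈Λ-refl (∂-mono-zero y Y S)) (∧-zeroʳ _)

  module _ {N : ℕ} {Circ : Subset N → Set} where
    Ideal-· : ∀ z {x} → Ideal Circ x → Ideal Circ (z · x)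
    Ideal-· z {x} p = resp (≈Λ-trans (∧-·ˡ z 1Λ x) (·-cong refl (∧-identityˡ x))) (lmul (z · 1Λ) p)

  module _ {N L : ℕ} {Circ : Subset N → Set} {Circ' : Subset L → Set}
           (g : Fin N → Λ L) (G : AllLinear g)
           (gen-image : ∀ {C} → Circ C → Ideal Circ' (extHom g (∂e C))) where
    extHom-Ideal : ∀ {x} → Ideal Circ x → Ideal Circ' (extHom g x)
    extHom-Ideal (gen C)    = gen-image C
    extHom-Ideal zer        = resp (≈Λ-sym (extHom-0Λ g)) zer
    extHom-Ideal (add p q)  = resp (≈Λ-sym (extHom-+Λ g _ _)) (add (extHom-Ideal p) (extHom-Ideal q))
    extHom-Ideal (lmul a p) = resp (≈Λ-sym (extHom-∧ g G a _)) (lmul (extHom g a) (extHom-Ideal p))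
    extHom-Ideal (rmul a p) = resp (≈Λ-sym (extHom-∧ g G _ a)) (rmul (extHom g a) (extHom-Ideal p))
    extHom-Ideal (resp e p) = resp (extHom-cong g e) (extHom-Ideal p)

∈-++⁺ˡ : ∀ {a b} {A : Subset a} {B : Subset b} {i} → i ∈ A → (i ↑ˡ b) ∈ (A ++ B)
∈-++⁺ˡ here      = here
∈-++⁺ˡ (there q) = there (∈-++⁺ˡ q)

∈-++⁺ʳ : ∀ {a b} (A : Subset a) {B : Subset b} {j} → j ∈ B → (a ↑ʳ j) ∈ (A ++ B)
∈-++⁺ʳ []      q = q
∈-++⁺ʳ (_ ∷ A) q = there (∈-++⁺ʳ A q)

∈-++⁻ : ∀ {a b} (A : Subset a) {B : Subset b} {x} → x ∈ (A ++ B) →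
  (Σ (Fin a) λ i → i ∈ A × i ↑ˡ b ≡ x) ⊎ (Σ (Fin b) λ j → j ∈ B × a ↑ʳ j ≡ x)
∈-++⁻ []           q         = inj₂ (_ , q , ≡.refl)
∈-++⁻ (inside ∷ A) here      = inj₁ (zero , here , ≡.refl)
∈-++⁻ (_ ∷ A)      (there q) with ∈-++⁻ A q
... | inj₁ (i , r , eq) = inj₁ (suc i , there r , ≡.cong suc eq)
... | inj₂ (j , r , eq) = inj₂ (j , r , ≡.cong suc eq)

module ParallelConnection {c ℓ} (K : CommutativeRing c ℓ) (m k : ℕ) (M₀ : Matroid k) (ε₀ : Fin k) where
  open CommutativeRing K hiding (zero)
  open Ext K
  open ExteriorAlgebra K
  open ΛReasoning

  n L : ℕ
  n = suc m
  L = n +ℕ k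

  g : Fin L → Λ L
  g = φgen n k ε₀

  bar′ : Fin L → Fin L
  bar′ = bar n k ε₀

  e : Fin L → Λ L
  e i = basis ⁅ i ⁆

  -- In the notation of the paper: p = e_p, z i = ē_{i+1}, zₙ = ē_n and y j = ē_{j+1} - ē_n.
  p : Λ L
  p = e zero

  z : Fin n → Λ L
  z i = e (bar′ (i ↑ˡ k))

  zₙ : Λ L
  zₙ = z (fromℕ m)

  y : Fin m → Λ L
  y j = z (inject₁ j) +Λ (-Λ zₙ)

  bar-↑ʳ : ∀ ε → bar′ (n ↑ʳ ε) ≡ n ↑ʳ ε
  bar-↑ʳ ε rewrite splitAt-↑ʳ n k ε = ≡.refl

  bar-suc-↑ˡ : ∀ (i : Fin m) → bar′ (suc i ↑ˡ k) ≡ suc i ↑ˡ k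
  bar-suc-↑ˡ i rewrite splitAt-↑ˡ n (suc i) k = ≡.refl

  φgen-↑ˡ : ∀ (i : Fin n) → g (i ↑ˡ k) ≡ φgenN k ε₀ i
  φgen-↑ˡ i rewrite splitAt-↑ˡ n i k = ≡.refl

  φgen-↑ʳ : ∀ ε → g (n ↑ʳ ε) ≡ e (n ↑ʳ ε)
  φgen-↑ʳ ε rewrite splitAt-↑ʳ n k ε = ≡.cong e (bar-↑ʳ ε)

  φgenN-fromℕ : φgenN k ε₀ (fromℕ m) ≡ p
  φgenN-fromℕ with toℕ (fromℕ m) ≟ m
  ... | yes _  = ≡.refl
  ... | no m≢m = ⊥-elim (m≢m (toℕ-fromℕ m))

  φgenN-inject₁ : ∀ j → φgenN k ε₀ (inject₁ j) ≡ (y j +Λ p)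
  φgenN-inject₁ j with toℕ (inject₁ j) ≟ m
  ... | yes j≡m = ⊥-elim (<-irrefl j≡m (≡.subst (_< m) (≡.sym (toℕ-inject₁ j)) (toℕ<n j)))
  ... | no _    = ≡.refl

  zₙ-Linear : Linear zₙ 1#
  zₙ-Linear = single (bar′ (fromℕ m ↑ˡ k))

  y-Linear : ∀ j → Linear (y j) 0#
  y-Linear j = respects ≈Λ-refl (-‿inverseʳ 1#)
    (plus (single (bar′ (inject₁ j ↑ˡ k))) (negate zₙ-Linear))

  φgenN-Linear : ∀ (i : Fin n) → Linear (φgenN k ε₀ i) 1#
  φgenN-Linear i with toℕ i ≟ m
  ... | yes _ = single zero
  ... | no _  = respects ≈Λ-refl (trans (+-cong (-‿inverseʳ 1#) refl) (+-identityˡ 1#))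
                  (plus (plus (single (bar′ (i ↑ˡ k))) (negate zₙ-Linear)) (single zero))

  φgen-Linear : ∀ x → Linear (g x) 1#
  φgen-Linear x = by-block (splitAt n x) ≡.refl
    where
    by-block : ∀ s → splitAt n x ≡ s → Linear (g x) 1#
    by-block (inj₁ i) eq = ≡.subst (λ t → Linear (g t) 1#) (splitAt⁻¹-↑ˡ {n} {k} {x} eq)
      (≡.subst (λ v → Linear v 1#) (≡.sym (φgen-↑ˡ i)) (φgenN-Linear i))
    by-block (inj₂ ε) eq = ≡.subst (λ t → Linear (g t) 1#) (splitAt⁻¹-↑ʳ {n} {k} {x} eq)
      (≡.subst (λ v → Linear v 1#) (≡.sym (φgen-↑ʳ ε)) (single (n ↑ʳ ε)))

  φgen-AllLinear : AllLinear g
  φgen-AllLinear x = 1# , φgen-Linear x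

  y-AllLinear : AllLinear y
  y-AllLinear j = 0# , y-Linear j

  Cₙ : Subset L
  Cₙ = full {n} ++ ∅ {k}

  D : Subset L
  D = (outside ∷ full {m}) ++ ⁅ ε₀ ⁆

  σ : Carrier
  σ = sign (full {m})

  mono-φgen-Cₙ : mono g Cₙ ≈Λ (mono y full ∧ p)
  mono-φgen-Cₙ = begin
    mono g Cₙ                                ≈⟨ mono-++ g (full {n}) (∅ {k}) ⟩
    mono h full ∧ mono (λ ε → g (n ↑ʳ ε)) ∅  ≈⟨ ∧-cong ≈Λ-refl (mono-∅ {k} (λ ε → g (n ↑ʳ ε))) ⟩
    mono h full ∧ 1Λ                         ≈⟨ ∧-identityʳ _ ⟩
    mono h full                              ≈⟨ mono-full-snoc m h ⟩
    mono (h ∘ inject₁) full ∧ h (fromℕ m)    ≈⟨ ∧-cong (mono-cong h-inject₁ (full {m})) (≈Λ-reflexive h-fromℕ) ⟩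
    mono (λ j → y j +Λ p) full ∧ p           ≈⟨ mono-translate-∧ y y-AllLinear (single zero) (full {m}) ⟩
    mono y full ∧ p                          ∎
    where
    h : Fin n → Λ L
    h i = g (i ↑ˡ k)
    h-inject₁ : ∀ j → h (inject₁ j) ≈Λ (y j +Λ p)
    h-inject₁ j = ≈Λ-reflexive (≡.trans (φgen-↑ˡ (inject₁ j)) (φgenN-inject₁ j))
    h-fromℕ : h (fromℕ m) ≡ p
    h-fromℕ = ≡.trans (φgen-↑ˡ (fromℕ m)) φgenN-fromℕ

  mono-z-y : mono z full ≈Λ (mono y full ∧ zₙ)
  mono-z-y = begin
    mono z full                       ≈⟨ mono-full-snoc m z ⟩
    mono (z ∘ inject₁) full ∧ zₙ      ≈⟨ ∧-cong (mono-cong (λ j U → sym (minus-plus _ _)) (full {m})) ≈Λ-refl ⟩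
    mono (λ j → y j +Λ zₙ) full ∧ zₙ  ≈⟨ mono-translate-∧ y y-AllLinear zₙ-Linear (full {m}) ⟩
    mono y full ∧ zₙ                  ∎
    where
    minus-plus : ∀ a b → (a + - b) + b ≈ a
    minus-plus a b = trans (+-assoc _ _ _) (trans (+-cong refl (-‿inverseˡ b)) (+-identityʳ a))

  -- σ comes from moving ē_1 = ē_{ε₀} past the other m factors to its place in e_D.
  mono-z-D : mono z full ≈Λ (σ · basis D)
  mono-z-D = begin
    z zero ∧ mono (z ∘ suc) full              ≈⟨ ∧-cong ≈Λ-refl (mono-cong (λ i → ≈Λ-reflexive (≡.cong e (bar-suc-↑ˡ i))) (full {m})) ⟩
    z zero ∧ W                                ≈⟨ ∧-mono-comm _ (λ i → 1# , single (suc i ↑ˡ k)) (single (n ↑ʳ ε₀)) (full {m}) ⟩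
    σ · (W ∧ z zero)                          ≈⟨ ·-cong refl (∧-cong ≈Λ-refl (mono-⁅⁆ (λ j → e (n ↑ʳ j)) ε₀)) ⟨
    σ · (W ∧ mono (λ j → e (n ↑ʳ j)) ⁅ ε₀ ⁆)  ≈⟨ ·-cong refl (mono-++ e (outside ∷ full {m}) ⁅ ε₀ ⁆) ⟨
    σ · mono e D                              ≈⟨ ·-cong refl (mono-basis D) ⟩
    σ · basis D                               ∎
    where
    W : Λ L
    W = mono (λ i → e (suc i ↑ˡ k)) full

  φ̂-∂Cₙ : extHom g (∂e Cₙ) ≈Λ (σ · ∂e D)
  φ̂-∂Cₙ = begin
    extHom g (∂e Cₙ)         ≈⟨ ∂-mono g φgen-Linear Cₙ ⟨
    ∂Λ (mono g Cₙ)           ≈⟨ ∂-cong mono-φgen-Cₙ ⟩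
    ∂Λ (mono y full ∧ p)     ≈⟨ ∂-mono-∧ y y-Linear (single zero) (full {m}) ⟩
    σ · mono y full          ≈⟨ ∂-mono-∧ y y-Linear zₙ-Linear (full {m}) ⟨
    ∂Λ (mono y full ∧ zₙ)    ≈⟨ ∂-cong mono-z-y ⟨
    ∂Λ (mono z full)         ≈⟨ ∂-cong mono-z-D ⟩
    ∂Λ (σ · basis D)         ≈⟨ ∂-· _ _ ⟩
    σ · ∂Λ (basis D)         ≈⟨ ·-cong refl (∂-basis D) ⟩
    σ · ∂e D                 ∎

  D-image : IsImage n k ε₀ Cₙ D
  D-image t = mk⇔ to from
    where
    to : t ∈ D → Σ (Fin L) λ x → x ∈ Cₙ × bar′ x ≡ t
    to q with ∈-++⁻ (outside ∷ full {m}) {⁅ ε₀ ⁆} q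
    ... | inj₁ (zero , () , _)
    ... | inj₁ (suc i , _ , eq) = suc i ↑ˡ k , ∈-++⁺ˡ ∈⊤ , ≡.trans (bar-suc-↑ˡ i) eq
    ... | inj₂ (j , r , eq)     = zero , here , ≡.trans (≡.cong (n ↑ʳ_) (≡.sym (x∈⁅y⁆⇒x≡y ε₀ r))) eq
    from : (Σ (Fin L) λ x → x ∈ Cₙ × bar′ x ≡ t) → t ∈ D
    from (x , q , eq) with ∈-++⁻ (full {n}) {∅ {k}} q
    ... | inj₂ (_ , r , _)       = ⊥-elim (∉⊥ r)
    ... | inj₁ (zero , _ , ex)   = ≡.subst (_∈ D) (≡.trans (≡.cong bar′ ex) eq) (∈-++⁺ʳ (outside ∷ full {m}) (x∈⁅x⁆ ε₀))
    ... | inj₁ (suc i , _ , ex)  = ≡.subst (_∈ D) (≡.trans (≡.cong bar′ ex) eq)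
                                     (≡.subst (_∈ D) (≡.sym (bar-suc-↑ˡ i)) (∈-++⁺ˡ {A = outside ∷ full} (there ∈⊤)))

  module _ (C' : Subset k) where
    X : Subset L
    X = ∅ {n} ++ C'

    mono-φgen-X : mono g X ≈Λ basis X
    mono-φgen-X = begin
      mono g X                                                ≈⟨ mono-++ g (∅ {n}) C' ⟩
      mono (λ i → g (i ↑ˡ k)) ∅ ∧ mono (λ ε → g (n ↑ʳ ε)) C'  ≈⟨ ∧-cong empty (mono-cong (≈Λ-reflexive ∘ φgen-↑ʳ) C') ⟩
      mono (λ i → e (i ↑ˡ k)) ∅ ∧ mono (λ ε → e (n ↑ʳ ε)) C'  ≈⟨ mono-++ e (∅ {n}) C' ⟨
      mono e X                                                ≈⟨ mono-basis X ⟩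
      basis X                                                 ∎
      where
      empty : mono (λ i → g (i ↑ˡ k)) ∅ ≈Λ mono (λ i → e (i ↑ˡ k)) ∅
      empty = ≈Λ-trans (mono-∅ {n} (λ i → g (i ↑ˡ k))) (≈Λ-sym (mono-∅ {n} (λ i → e (i ↑ˡ k))))

    φ̂-∂X : extHom g (∂e X) ≈Λ ∂e X
    φ̂-∂X = ≈Λ-trans (≈Λ-sym (∂-mono g φgen-Linear X)) (≈Λ-trans (∂-cong mono-φgen-X) (∂-basis X))

    bar-X : ∀ {x} → x ∈ X → bar′ x ≡ x
    bar-X q with ∈-++⁻ (∅ {n}) {C'} q
    ... | inj₁ (_ , r , _)  = ⊥-elim (∉⊥ r)
    ... | inj₂ (j , _ , eq) = ≡.subst (λ x → bar′ x ≡ x) eq (bar-↑ʳ j)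

    X-image : IsImage n k ε₀ X X
    X-image t = mk⇔ (λ q → t , q , bar-X q)
                    (λ { (x , q , eq) → ≡.subst (_∈ X) (≡.trans (≡.sym (bar-X q)) eq) q })

  φ̂-∂circuit : ∀ {C} → CircM n k M₀ C → Ideal (CircM' n k M₀ ε₀) (extHom g (∂e C))
  φ̂-∂circuit (inj₁ (_ , ≡.refl , ≡.refl)) =
    resp (≈Λ-sym φ̂-∂Cₙ) (Ideal-· _ (gen (inj₁ (Cₙ , inj₁ (full , ≡.refl , ≡.refl) , D-image))))
  φ̂-∂circuit (inj₂ (C' , circuit , ≡.refl)) =
    resp (≈Λ-sym (φ̂-∂X C')) (gen (inj₁ (X C' , inj₂ (C' , circuit , ≡.refl) , X-image C')))

lemma3p4 : ∀ {c ℓ} (K : CommutativeRing c ℓ) (n k : ℕ) → 3 ≤ n →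
    (M₀ : Matroid k) → Simple M₀ → (ε₀ : Fin k) →
    ∀ x → Ext.Ideal K (CircM n k M₀) x →
    Ext.Ideal K (CircM' n k M₀ ε₀) (Ext.φ̂ K n k ε₀ x)
lemma3p4 K (suc m) k (s≤s _) M₀ _ ε₀ _ =
  extHom-Ideal g φgen-AllLinear φ̂-∂circuit
  where
  open ExteriorAlgebra K
  open ParallelConnection K m k M₀ ε₀
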